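{- Let $\mu$ be a partition of $n+1$. If $\mathcal B^*_\mu=\{b^*(x_1,\dots,x_{n+1};y_1,\dots,y_{n+1})\}$ is a basis of $\mathbf M_\mu$, then the collection $\{b^*(x_1,\dots,x_n,0;y_1,\dots,y_n,0):b^*\in\mathcal B^*_\mu\}$ is a basis of $\mathbf M_{\mu/00}$.
   Context: Lattice cells are pairs $(i,j)$ of nonnegative integers; the Ferrers diagram of $\mu$ is $\{(i,j):0\le j\le\mu_{i+1}-1\}$. For a set $L$ of $N$ distinct cells listed lexicographically as $(p_1,q_1),\dots,(p_N,q_N)$, $\Delta_L=\frac1{p!q!}\det\|x_r^{p_c}y_r^{q_c}\|_{r,c=1}^N$, a polynomial in $x_1,\dots,x_N,y_1,\dots,y_N$, and $\mathbf M_L$ is the span of all its partial derivatives of all orders. $\mu/00$ is $\mu$ with the cell $(0,0)$ removed, so $\mathbf M_{\mu/00}$ consists of polynomials in $x_1,\dots,x_n,y_1,\dots,y_n$. -}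

module Defs where

open import Data.Nat as ℕ using (ℕ; zero; suc; pred; _!; _≡ᵇ_)
open import Data.Nat.Properties using (_!*_!≢0)
open import Data.Integer using (+_)
open import Data.Rational as ℚ using (ℚ; 0ℚ; 1ℚ; _/_)
open import Data.Fin using (Fin; zero; suc)
open import Data.List as List using (List; []; _∷_; _++_; concatMap)
open import Data.Nat.ListAction using (sum)
open import Data.Vec as Vec using (Vec; []; _∷_; replicate; _[_]≔_; updateAt; lookup; removeAt; tabulate; init; last; zipWith)
open import Data.Vec.Relation.Unary.All using (All)
open import Data.Product using (Σ; _×_; _,_)
open import Data.Bool using (if_then_else_; _∧_)
open import Relation.Nullary.Decidable using (does)
open import Relation.Binary.PropositionalEquality using (_≡_)
import Data.Vec.Properties as VecP
open import Data.Product.Properties using (≡-dec)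

Cell : Set
Cell = ℕ × ℕ

data Decreasing : List ℕ → Set where
  []  : Decreasing []
  [-] : ∀ {a} → Decreasing (a ∷ [])
  _∷_ : ∀ {a b μ} → b ℕ.≤ a → Decreasing (b ∷ μ) → Decreasing (a ∷ b ∷ μ)

data Positive : List ℕ → Set where
  []  : Positive []
  _∷_ : ∀ {a μ} → 0 ℕ.< a → Positive μ → Positive (a ∷ μ)

record IsPartitionOf (m : ℕ) (μ : List ℕ) : Set where
  field
    decreasing : Decreasing μ
    positive   : Positive μ
    total      : sum μ ≡ m

row : ℕ → (a : ℕ) → Vec Cell a
row i a = tabulate (λ j → i , Data.Fin.toℕ j)

cellsFrom : ℕ → (μ : List ℕ) → Vec Cell (sum μ)
cellsFrom i []      = []
cellsFrom i (a ∷ μ) = row i a Vec.++ cellsFrom (suc i) μ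

ferrers : (μ : List ℕ) → Vec Cell (sum μ)
ferrers μ = cellsFrom 0 μ

-- remove the first cell (for a partition, this is the cell (0,0))
dropFirst : ∀ {k} {A : Set} → Vec A k → Vec A (pred k)
dropFirst []       = []
dropFirst (_ ∷ xs) = xs

ferrers/00 : (μ : List ℕ) → Vec Cell (pred (sum μ))
ferrers/00 μ = dropFirst (ferrers μ)

-- a monomial x^a y^b  (a , b = exponent vectors)
Mono : ℕ → Set
Mono k = Vec ℕ k × Vec ℕ k

-- a polynomial, as a finite formal sum of terms c·x^a y^b
Poly : ℕ → Set
Poly k = List (ℚ × Mono k)

monoEq? : ∀ {k} (m m′ : Mono k) → Data.Bool.Bool
monoEq? m m′ = does (≡-dec (VecP.≡-dec ℕ._≟_) (VecP.≡-dec ℕ._≟_) m m′)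

coeff : ∀ {k} → Poly k → Mono k → ℚ
coeff []              m = 0ℚ
coeff ((c , m′) ∷ p)  m = (if monoEq? m′ m then c else 0ℚ) ℚ.+ coeff p m

infix 4 _≈_
_≈_ : ∀ {k} → Poly k → Poly k → Set
p ≈ q = ∀ m → coeff p m ≡ coeff q m

0P : ∀ {k} → Poly k
0P = []

1P : ∀ {k} → Poly k
1P {k} = (1ℚ , replicate k 0 , replicate k 0) ∷ []

infixl 6 _+P_
_+P_ : ∀ {k} → Poly k → Poly k → Poly k
p +P q = p ++ q

scale : ∀ {k} → ℚ → Poly k → Poly k
scale c p = List.map (λ { (d , m) → (c ℚ.* d , m) }) p

infixl 7 _*P_
_*P_ : ∀ {k} → Poly k → Poly k → Poly k
p *P q = concatMap (λ { (c , a , b) →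
           List.map (λ { (d , a′ , b′) → (c ℚ.* d , zipWith ℕ._+_ a a′ , zipWith ℕ._+_ b b′) }) q }) p

ℕtoℚ : ℕ → ℚ
ℕtoℚ e = + e / 1

∂x : ∀ {k} → Fin k → Poly k → Poly k
∂x i p = List.map (λ { (c , a , b) → (c ℚ.* ℕtoℚ (lookup a i) , updateAt a i pred , b) }) p

∂y : ∀ {k} → Fin k → Poly k → Poly k
∂y i p = List.map (λ { (c , a , b) → (c ℚ.* ℕtoℚ (lookup b i) , a , updateAt b i pred) }) p

-- substitution x_k = y_k = 0 of the last pair of variables
restrict : ∀ {k} → Poly k → Poly (pred k)
restrict {zero}  p = p
restrict {suc k} p = List.map (λ { (c , a , b) →
  ((if (last a ≡ᵇ 0) ∧ (last b ≡ᵇ 0) then c else 0ℚ) , init a , init b) }) p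

alt : ℕ → ℚ
alt zero    = 1ℚ
alt (suc n) = ℚ.- alt n

sumP : ∀ {k n} → Vec (Poly k) n → Poly k
sumP = Vec.foldr _ _+P_ 0P

det : ∀ {k N} → Vec (Vec (Poly k) N) N → Poly k
det {N = zero}  []      = 1P
det {N = suc N} (r ∷ M) =
  sumP (tabulate (λ j → scale (alt (Data.Fin.toℕ j))
                          (lookup r j *P det (Vec.map (λ r′ → removeAt r′ j) M))))

xyPow : ∀ {N} → Fin N → ℕ → ℕ → Poly N
xyPow {N} r p q = (1ℚ , replicate N 0 [ r ]≔ p , replicate N 0 [ r ]≔ q) ∷ []

normalizer : ∀ {N} → Vec Cell N → ℚ
normalizer []            = 1ℚ
normalizer ((p , q) ∷ L) = (_/_ (+ 1) (p ! ℕ.* q !) {{p !* q !≢0}}) ℚ.* normalizer L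

Δ : ∀ {N} → Vec Cell N → Poly N
Δ L = scale (normalizer L)
        (det (tabulate (λ r → Vec.map (λ { (p , q) → xyPow r p q }) L)))

data IsDeriv {k} (D : Poly k) : Poly k → Set where
  here : IsDeriv D D
  dx   : ∀ i {q} → IsDeriv D q → IsDeriv D (∂x i q)
  dy   : ∀ i {q} → IsDeriv D q → IsDeriv D (∂y i q)

lincomb : ∀ {k m} → Vec ℚ m → Vec (Poly k) m → Poly k
lincomb cs vs = sumP (zipWith scale cs vs)

InM : ∀ {k} → Poly k → Poly k → Set
InM {k} D p = Σ ℕ λ m → Σ (Vec (Poly k) m) λ ds → Σ (Vec ℚ m) λ cs →
                All (IsDeriv D) ds × (p ≈ lincomb cs ds)

InML : ∀ {N} → Vec Cell N → Poly N → Set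
InML L = InM (Δ L)

LinIndep : ∀ {k m} → Vec (Poly k) m → Set
LinIndep {m = m} B = ∀ (cs : Vec ℚ m) → lincomb cs B ≈ 0P → cs ≡ replicate m 0ℚ

Spans : ∀ {k m} → (Poly k → Set) → Vec (Poly k) m → Set
Spans {m = m} V B = ∀ p → V p → Σ (Vec ℚ m) λ cs → p ≈ lincomb cs B

record IsBasis {k m} (V : Poly k → Set) (B : Vec (Poly k) m) : Set where
  field
    members : All V B
    indep   : LinIndep B
    spans   : Spans V B

module Submission where

-- Write P̄ for P with x_{n+1} = y_{n+1} = 0.  The column of Δ_μ belonging to the
-- cell (0,0) is constant, so expanding along the last row gives Δ̄_μ = ±Δ_{μ/00};
-- moreover restriction commutes with ∂/∂x_i and ∂/∂y_i for i ≤ n.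
--
-- Since μ is a Ferrers diagram, Δ_μ, and with it all of M_μ, is killed by the
-- translation generators Σᵢ ∂/∂xᵢ and Σᵢ ∂/∂yᵢ: applied to the determinant they
-- give sums of determinants with a repeated column.  For such P the derivative in
-- x_{n+1} (or y_{n+1}) is minus the sum of the other ones, so (i) restriction maps
-- derivatives of Δ_μ into M_{μ/00}, and every derivative of Δ_{μ/00} lifts to one
-- of Δ_μ, which gives spanning; and (ii) by induction on the exponents of
-- x_{n+1}, y_{n+1}, P̄ = 0 forces P = 0, which gives independence.

open import Defs
open import Data.Nat using (ℕ; suc; pred)
open import Data.List using (List)
open import Data.Nat.ListAction using (sum)
open import Data.Vec using (Vec; map)

open import Algebra.Bundles using (Ring; CommutativeMonoid)
import Algebra.Solver.CommutativeMonoid as CommutativeMonoidSolver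
open import Data.Bool using (Bool; true; false; if_then_else_; _∧_)
import Data.Bool.Properties as BoolP
open import Data.Empty using (⊥-elim)
open import Data.Fin as Fin using (Fin; zero; suc; toℕ; inject₁; fromℕ; punchIn)
import Data.Fin.Properties as FinP
import Data.Fin.Relation.Unary.Top as Top
open Top using (‵fromℕ; ‵inject₁)
import Data.Integer as ℤ
import Data.Integer.Properties as ℤP
open import Data.List as List using ([]; _∷_; _++_; [_])
open import Data.List.Membership.Propositional using (_∈_)
open import Data.List.Membership.Propositional.Properties using (∈-++⁻; ∈-∃++; ∈-++⁺ˡ; ∈-++⁺ʳ)
import Data.List.Properties as ListP
open import Data.List.Relation.Binary.Pointwise as Pointwise using (Pointwise; []; _∷_)
open import Data.List.Relation.Unary.All as All using (All; []; _∷_)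
open import Data.List.Relation.Unary.Any using (here; there)
open import Data.Nat as ℕ using (zero; _≡ᵇ_; _∸_; _≤_; _<_; z≤n; s≤s)
open import Data.Nat.Divisibility using (∣1⇒≡1)
import Data.Nat.Properties as ℕP
open import Data.Product using (Σ; _×_; _,_; proj₁; proj₂)
open import Data.Product.Properties using (≡-dec)
open import Data.Rational as ℚ using (ℚ; 0ℚ; 1ℚ; mkℚ; _+_; _*_)
import Data.Rational.Properties as ℚP
open import Data.Rational.Solver using (module +-*-Solver)
open import Data.Sum using (_⊎_; inj₁; inj₂)
open import Data.Unit using (⊤)
open import Data.Vec as Vec using ([]; _∷_; lookup; updateAt; tabulate; toList; removeAt; replicate; _[_]≔_; _∷ʳ_; init; last)
import Data.Vec.Properties as VecP
open import Data.Vec.Relation.Unary.All as VecAll using ([]; _∷_)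
import Data.Vec.Relation.Unary.All.Properties as VecAllP
open import Function using (_∘_)
open import Relation.Binary.Bundles using (Setoid)
open import Relation.Binary.PropositionalEquality hiding ([_])
import Relation.Binary.Reasoning.Setoid as SetoidReasoning
open import Relation.Nullary using (Dec; yes; no)
open import Relation.Nullary.Decidable using (dec-true; dec-false)

open +-*-Solver
open import Algebra.Properties.Semiring.Sum (Ring.semiring ℚP.+-*-ring)
  using (sum-cong-≗; ∑-distrib-+; *-distribˡ-sum; sum-init-last; sum-remove; sum-replicate-zero)
  renaming (sum to ∑)

-1q : ℚ
-1q = ℚ.- 1ℚ

ℕtoℚ-mkℚ : ∀ a → ℕtoℚ a ≡ mkℚ (ℤ.+ a) 0 (λ { (_ , d) → ∣1⇒≡1 d })
ℕtoℚ-mkℚ a = ℚP.normalize-coprime {a} {0} (λ { (_ , d) → ∣1⇒≡1 d })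

ℕtoℚ-+ : ∀ a b → ℕtoℚ (a ℕ.+ b) ≡ ℕtoℚ a + ℕtoℚ b
ℕtoℚ-+ a b rewrite ℕtoℚ-mkℚ a | ℕtoℚ-mkℚ b =
  ℚP./-cong {p₁ = ℤ.+ (a ℕ.+ b)} {q₁ = 1} {q₂ = 1}
    (sym (cong₂ ℤ._+_ (ℤP.*-identityʳ (ℤ.+ a)) (ℤP.*-identityʳ (ℤ.+ b)))) refl

ℕtoℚ-suc-cancel : ∀ k {c} → ℕtoℚ (suc k) * c ≡ 0ℚ → c ≡ 0ℚ
ℕtoℚ-suc-cancel k {c} e rewrite ℕtoℚ-mkℚ (suc k) = begin
  c                 ≡⟨ sym (ℚP.*-identityˡ c) ⟩
  1ℚ * c            ≡⟨ cong (_* c) (sym (ℚP.*-inverseˡ q)) ⟩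
  (ℚ.1/ q * q) * c  ≡⟨ ℚP.*-assoc (ℚ.1/ q) q c ⟩
  ℚ.1/ q * (q * c)  ≡⟨ cong (ℚ.1/ q *_) e ⟩
  ℚ.1/ q * 0ℚ       ≡⟨ ℚP.*-zeroʳ (ℚ.1/ q) ⟩
  0ℚ                ∎
  where
  open ≡-Reasoning
  q : ℚ
  q = mkℚ (ℤ.+ suc k) 0 (λ { (_ , d) → ∣1⇒≡1 d })

≡-neg⇒≡0 : ∀ {c} → c ≡ -1q * c → c ≡ 0ℚ
≡-neg⇒≡0 {c} e = ℕtoℚ-suc-cancel 1 (begin
  ℕtoℚ 2 * c   ≡⟨ solve 1 (λ c → (con 1ℚ :+ con 1ℚ) :* c := c :+ c) refl c ⟩
  c + c        ≡⟨ cong (c +_) e ⟩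
  c + -1q * c  ≡⟨ solve 1 (λ c → c :+ (:- con 1ℚ) :* c := con 0ℚ) refl c ⟩
  0ℚ           ∎)
  where open ≡-Reasoning

alt-suc : ∀ n → alt (suc n) ≡ -1q * alt n
alt-suc n = solve 1 (λ a → :- a := (:- con 1ℚ) :* a) refl (alt n)

alt-involutive : ∀ n → alt n * alt n ≡ 1ℚ
alt-involutive zero    = refl
alt-involutive (suc n) = trans (solve 1 (λ a → (:- a) :* (:- a) := a :* a) refl (alt n)) (alt-involutive n)

∑-0 : ∀ {n} (f : Fin n → ℚ) → (∀ i → f i ≡ 0ℚ) → ∑ f ≡ 0ℚ
∑-0 {n} f f≡0 = trans (sum-cong-≗ f≡0) (sum-replicate-zero n)

∑-single : ∀ {n} (f : Fin n → ℚ) (j : Fin n) → (∀ i → i ≢ j → f i ≡ 0ℚ) → ∑ f ≡ f j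
∑-single {suc n} f j f≡0 = begin
  ∑ f                      ≡⟨ sum-remove {i = j} f ⟩
  f j + ∑ (f ∘ punchIn j)  ≡⟨ cong (f j +_) (∑-0 _ (λ i → f≡0 _ (FinP.punchInᵢ≢i j i))) ⟩
  f j + 0ℚ                 ≡⟨ ℚP.+-identityʳ (f j) ⟩
  f j                      ∎
  where open ≡-Reasoning

lsum : ∀ {A : Set} → (A → ℚ) → List A → ℚ
lsum f []       = 0ℚ
lsum f (x ∷ xs) = f x + lsum f xs

lsum-++ : ∀ {A : Set} (f : A → ℚ) xs ys → lsum f (xs ++ ys) ≡ lsum f xs + lsum f ys
lsum-++ f []       ys = sym (ℚP.+-identityˡ _)
lsum-++ f (x ∷ xs) ys rewrite lsum-++ f xs ys = sym (ℚP.+-assoc (f x) _ _)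

lsum-map : ∀ {A B : Set} (f : B → ℚ) (g : A → B) xs → lsum f (List.map g xs) ≡ lsum (f ∘ g) xs
lsum-map f g []       = refl
lsum-map f g (x ∷ xs) = cong (f (g x) +_) (lsum-map f g xs)

lsum-concatMap : ∀ {A B : Set} (f : B → ℚ) (h : A → List B) xs →
  lsum f (List.concatMap h xs) ≡ lsum (lsum f ∘ h) xs
lsum-concatMap f h []       = refl
lsum-concatMap f h (x ∷ xs) =
  trans (lsum-++ f (h x) (List.concatMap h xs)) (cong (lsum f (h x) +_) (lsum-concatMap f h xs))

lsum-cong : ∀ {A : Set} {f g : A → ℚ} → (∀ x → f x ≡ g x) → ∀ xs → lsum f xs ≡ lsum g xs
lsum-cong f≡g []       = refl
lsum-cong f≡g (x ∷ xs) = cong₂ _+_ (f≡g x) (lsum-cong f≡g xs)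

lsum-+ : ∀ {A : Set} (f g : A → ℚ) xs → lsum (λ x → f x + g x) xs ≡ lsum f xs + lsum g xs
lsum-+ f g []       = sym (ℚP.+-identityˡ 0ℚ)
lsum-+ f g (x ∷ xs) rewrite lsum-+ f g xs =
  solve 4 (λ a b c d → (a :+ b) :+ (c :+ d) := (a :+ c) :+ (b :+ d)) refl (f x) (g x) (lsum f xs) (lsum g xs)

lsum-*ˡ : ∀ {A : Set} (c : ℚ) (f : A → ℚ) xs → lsum (λ x → c * f x) xs ≡ c * lsum f xs
lsum-*ˡ c f []       = sym (ℚP.*-zeroʳ c)
lsum-*ˡ c f (x ∷ xs) rewrite lsum-*ˡ c f xs = sym (ℚP.*-distribˡ-+ c (f x) (lsum f xs))

lsum-0 : ∀ {A : Set} (f : A → ℚ) → (∀ x → f x ≡ 0ℚ) → ∀ xs → lsum f xs ≡ 0ℚ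
lsum-0 f f≡0 []       = refl
lsum-0 f f≡0 (x ∷ xs) rewrite f≡0 x | lsum-0 f f≡0 xs = refl

lsum-comm : ∀ {A B : Set} (F : A → B → ℚ) xs ys →
  lsum (λ x → lsum (F x) ys) xs ≡ lsum (λ y → lsum (λ x → F x y) xs) ys
lsum-comm F []       ys = sym (lsum-0 _ (λ _ → refl) ys)
lsum-comm F (x ∷ xs) ys rewrite lsum-comm F xs ys = sym (lsum-+ (F x) _ ys)

Term : ℕ → Set
Term k = ℚ × Mono k

_≟M_ : ∀ {k} (m m′ : Mono k) → Dec (m ≡ m′)
_≟M_ = ≡-dec (VecP.≡-dec ℕ._≟_) (VecP.≡-dec ℕ._≟_)

opaque
  termCoeff : ∀ {k} → Term k → Mono k → ℚ
  termCoeff (c , m′) m = if monoEq? m′ m then c else 0ℚ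

  termCoeff-≡ : ∀ {k} c (m : Mono k) → termCoeff (c , m) m ≡ c
  termCoeff-≡ c m rewrite dec-true (m ≟M m) refl = refl

  termCoeff-≢ : ∀ {k} c {m′ m : Mono k} → m′ ≢ m → termCoeff (c , m′) m ≡ 0ℚ
  termCoeff-≢ c {m′} {m} m′≢m rewrite dec-false (m′ ≟M m) m′≢m = refl

  termCoeff-0 : ∀ {k} (m′ m : Mono k) → termCoeff (0ℚ , m′) m ≡ 0ℚ
  termCoeff-0 m′ m with monoEq? m′ m
  ... | true  = refl
  ... | false = refl

  termCoeff-*ˡ : ∀ {k} d c (m′ m : Mono k) → termCoeff (d * c , m′) m ≡ d * termCoeff (c , m′) m
  termCoeff-*ˡ d c m′ m with monoEq? m′ m
  ... | true  = refl
  ... | false = sym (ℚP.*-zeroʳ d)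

  termCoeff-+ : ∀ {k} c d (m′ m : Mono k) → termCoeff (c + d , m′) m ≡ termCoeff (c , m′) m + termCoeff (d , m′) m
  termCoeff-+ c d m′ m with monoEq? m′ m
  ... | true  = refl
  ... | false = refl

  coeff-lsum : ∀ {k} (p : Poly k) m → coeff p m ≡ lsum (λ t → termCoeff t m) p
  coeff-lsum []             m = refl
  coeff-lsum ((c , m′) ∷ p) m = cong (termCoeff (c , m′) m +_) (coeff-lsum p m)

termCoeff-cong : ∀ {k} {c d} {m₁ m₂ : Mono k} m → c ≡ d → m₁ ≡ m₂ → termCoeff (c , m₁) m ≡ termCoeff (d , m₂) m
termCoeff-cong m refl refl = refl

termCoeff-0-or-≡ : ∀ {k} {c} {m₁ m₂ : Mono k} m → m₁ ≡ m₂ ⊎ c ≡ 0ℚ → termCoeff (c , m₁) m ≡ termCoeff (c , m₂) m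
termCoeff-0-or-≡ m (inj₁ refl) = refl
termCoeff-0-or-≡ {m₁ = m₁} {m₂} m (inj₂ refl) = trans (termCoeff-0 m₁ m) (sym (termCoeff-0 m₂ m))

coeff-singleton : ∀ {k} (t : Term k) m → coeff (t ∷ []) m ≡ termCoeff t m
coeff-singleton t m = trans (coeff-lsum (t ∷ []) m) (ℚP.+-identityʳ _)

coeff-+P : ∀ {k} (p q : Poly k) m → coeff (p +P q) m ≡ coeff p m + coeff q m
coeff-+P p q m = begin
  coeff (p +P q) m                                             ≡⟨ coeff-lsum (p +P q) m ⟩
  lsum (λ t → termCoeff t m) (p +P q)                          ≡⟨ lsum-++ _ p q ⟩
  lsum (λ t → termCoeff t m) p + lsum (λ t → termCoeff t m) q  ≡⟨ sym (cong₂ _+_ (coeff-lsum p m) (coeff-lsum q m)) ⟩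
  coeff p m + coeff q m                                        ∎
  where open ≡-Reasoning

coeff-map : ∀ {k j} (g : Term k → Term j) (p : Poly k) m → coeff (List.map g p) m ≡ lsum (λ t → termCoeff (g t) m) p
coeff-map g p m = trans (coeff-lsum (List.map g p) m) (lsum-map _ g p)

coeff-scale : ∀ {k} c (p : Poly k) m → coeff (scale c p) m ≡ c * coeff p m
coeff-scale c p m = begin
  coeff (scale c p) m                                 ≡⟨ coeff-map _ p m ⟩
  lsum (λ { (d , m′) → termCoeff (c * d , m′) m }) p  ≡⟨ lsum-cong (λ { (d , m′) → termCoeff-*ˡ c d m′ m }) p ⟩
  lsum (λ t → c * termCoeff t m) p                    ≡⟨ lsum-*ˡ c _ p ⟩
  c * lsum (λ t → termCoeff t m) p                    ≡⟨ cong (c *_) (sym (coeff-lsum p m)) ⟩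
  c * coeff p m                                       ∎
  where open ≡-Reasoning

-- A record around _≈_, so that the two polynomials can be inferred.
infix 4 _≋_
record _≋_ {k} (p q : Poly k) : Set where
  constructor ≈⇒≋
  field ≋⇒≈ : p ≈ q
open _≋_ public

≋-refl : ∀ {k} {p : Poly k} → p ≋ p
≋-refl = ≈⇒≋ λ m → refl

≋-sym : ∀ {k} {p q : Poly k} → p ≋ q → q ≋ p
≋-sym e = ≈⇒≋ λ m → sym (≋⇒≈ e m)

≋-trans : ∀ {k} {p q r : Poly k} → p ≋ q → q ≋ r → p ≋ r
≋-trans e f = ≈⇒≋ λ m → trans (≋⇒≈ e m) (≋⇒≈ f m)

≡⇒≋ : ∀ {k} {p q : Poly k} → p ≡ q → p ≋ q
≡⇒≋ refl = ≋-refl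

≋-setoid : ℕ → Setoid _ _
≋-setoid k = record
  { Carrier = Poly k ; _≈_ = _≋_
  ; isEquivalence = record { refl = ≋-refl ; sym = ≋-sym ; trans = ≋-trans } }

module ≋-Reasoning {k} = SetoidReasoning (≋-setoid k)

+P-cong : ∀ {k} {p p′ q q′ : Poly k} → p ≋ p′ → q ≋ q′ → p +P q ≋ p′ +P q′
+P-cong {p = p} {p′} {q} {q′} e f = ≈⇒≋ λ m → begin
  coeff (p +P q) m         ≡⟨ coeff-+P p q m ⟩
  coeff p m + coeff q m    ≡⟨ cong₂ _+_ (≋⇒≈ e m) (≋⇒≈ f m) ⟩
  coeff p′ m + coeff q′ m  ≡⟨ sym (coeff-+P p′ q′ m) ⟩
  coeff (p′ +P q′) m       ∎
  where open ≡-Reasoning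

+P-identityʳ : ∀ {k} (p : Poly k) → p +P 0P ≋ p
+P-identityʳ p = ≡⇒≋ (ListP.++-identityʳ p)

+P-assoc : ∀ {k} (p q r : Poly k) → (p +P q) +P r ≋ p +P (q +P r)
+P-assoc p q r = ≡⇒≋ (ListP.++-assoc p q r)

+P-comm : ∀ {k} (p q : Poly k) → p +P q ≋ q +P p
+P-comm p q = ≈⇒≋ λ m → trans (coeff-+P p q m) (trans (ℚP.+-comm (coeff p m) (coeff q m)) (sym (coeff-+P q p m)))

+P-commutativeMonoid : ℕ → CommutativeMonoid _ _
+P-commutativeMonoid k = record
  { Carrier = Poly k ; _≈_ = _≋_ ; _∙_ = _+P_ ; ε = 0P
  ; isCommutativeMonoid = record
    { isMonoid = record
      { isSemigroup = record
        { isMagma = record { isEquivalence = Setoid.isEquivalence (≋-setoid k) ; ∙-cong = +P-cong }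
        ; assoc = +P-assoc }
      ; identity = (λ p → ≋-refl) , +P-identityʳ }
    ; comm = +P-comm } }

module +P-Solver {k} = CommutativeMonoidSolver (+P-commutativeMonoid k)

scale-cong : ∀ {k} c {p q : Poly k} → p ≋ q → scale c p ≋ scale c q
scale-cong c {p} {q} e = ≈⇒≋ λ m →
  trans (coeff-scale c p m) (trans (cong (c *_) (≋⇒≈ e m)) (sym (coeff-scale c q m)))

scale-+P : ∀ {k} c (p q : Poly k) → scale c (p +P q) ≋ scale c p +P scale c q
scale-+P c p q = ≡⇒≋ (ListP.map-++ _ p q)

scale-scale : ∀ {k} a b (p : Poly k) → scale a (scale b p) ≋ scale (a * b) p
scale-scale a b p = ≈⇒≋ λ m → begin
  coeff (scale a (scale b p)) m  ≡⟨ coeff-scale a (scale b p) m ⟩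
  a * coeff (scale b p) m        ≡⟨ cong (a *_) (coeff-scale b p m) ⟩
  a * (b * coeff p m)            ≡⟨ sym (ℚP.*-assoc a b (coeff p m)) ⟩
  a * b * coeff p m              ≡⟨ sym (coeff-scale (a * b) p m) ⟩
  coeff (scale (a * b) p) m      ∎
  where open ≡-Reasoning

scale-comm : ∀ {k} a b (p : Poly k) → scale a (scale b p) ≋ scale b (scale a p)
scale-comm a b p = ≋-trans (scale-scale a b p)
  (≋-trans (≡⇒≋ (cong (λ c → scale c p) (ℚP.*-comm a b))) (≋-sym (scale-scale b a p)))

scale-distribʳ : ∀ {k} c d (p : Poly k) → scale (c + d) p ≋ scale c p +P scale d p
scale-distribʳ c d p = ≈⇒≋ λ m → begin
  coeff (scale (c + d) p) m                 ≡⟨ coeff-scale (c + d) p m ⟩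
  (c + d) * coeff p m                      ≡⟨ ℚP.*-distribʳ-+ (coeff p m) c d ⟩
  c * coeff p m + d * coeff p m           ≡⟨ sym (cong₂ _+_ (coeff-scale c p m) (coeff-scale d p m)) ⟩
  coeff (scale c p) m + coeff (scale d p) m ≡⟨ sym (coeff-+P (scale c p) (scale d p) m) ⟩
  coeff (scale c p +P scale d p) m           ∎
  where open ≡-Reasoning

scale-0ℚ : ∀ {k} (p : Poly k) → scale 0ℚ p ≋ 0P
scale-0ℚ p = ≈⇒≋ λ m → trans (coeff-scale 0ℚ p m) (ℚP.*-zeroˡ (coeff p m))

scale-1ℚ : ∀ {k} (p : Poly k) → scale 1ℚ p ≋ p
scale-1ℚ p = ≈⇒≋ λ m → trans (coeff-scale 1ℚ p m) (ℚP.*-identityˡ (coeff p m))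

neg : ∀ {k} → Poly k → Poly k
neg = scale -1q

coeff-neg : ∀ {k} (p : Poly k) m → coeff (neg p) m ≡ ℚ.- coeff p m
coeff-neg p m = trans (coeff-scale -1q p m) (solve 1 (λ x → (:- con 1ℚ) :* x := :- x) refl (coeff p m))

scale-alt-suc : ∀ {k} n (p : Poly k) → scale (alt (suc n)) p ≋ neg (scale (alt n) p)
scale-alt-suc n p = ≋-trans (≡⇒≋ (cong (λ c → scale c p) (alt-suc n))) (≋-sym (scale-scale -1q (alt n) p))

≋-neg⇒≋0 : ∀ {k} {p : Poly k} → p ≋ neg p → p ≋ 0P
≋-neg⇒≋0 {p = p} e = ≈⇒≋ λ m → ≡-neg⇒≡0 (trans (≋⇒≈ e m) (coeff-scale -1q p m))

infixl 6 _+ᵥ_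
_+ᵥ_ : ∀ {k} → Vec ℕ k → Vec ℕ k → Vec ℕ k
_+ᵥ_ = Vec.zipWith ℕ._+_

infixl 7 _·M_ _·T_
_·M_ : ∀ {k} → Mono k → Mono k → Mono k
(a , b) ·M (a′ , b′) = (a +ᵥ a′ , b +ᵥ b′)

_·T_ : ∀ {k} → Term k → Term k → Term k
(c , m) ·T (d , m′) = (c * d , m ·M m′)

coeff-*P : ∀ {k} (p q : Poly k) m →
  coeff (p *P q) m ≡ lsum (λ t → lsum (λ t′ → termCoeff (t ·T t′) m) q) p
coeff-*P p q m = trans (coeff-lsum (p *P q) m)
  (trans (lsum-concatMap _ (λ t → List.map (t ·T_) q) p) (lsum-cong (λ t → lsum-map _ (t ·T_) q) p))

·M-comm : ∀ {k} (x y : Mono k) → x ·M y ≡ y ·M x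
·M-comm (a , b) (a′ , b′) = cong₂ _,_ (VecP.zipWith-comm ℕP.+-comm a a′) (VecP.zipWith-comm ℕP.+-comm b b′)

+ᵥ-identityˡ : ∀ {k} (a : Vec ℕ k) → Vec.replicate k 0 +ᵥ a ≡ a
+ᵥ-identityˡ = VecP.zipWith-identityˡ ℕP.+-identityˡ

+ᵥ-cancelˡ : ∀ {k} (a : Vec ℕ k) {x y} → a +ᵥ x ≡ a +ᵥ y → x ≡ y
+ᵥ-cancelˡ []      {[]}     {[]}     e = refl
+ᵥ-cancelˡ (z ∷ a) {x ∷ xs} {y ∷ ys} e =
  cong₂ _∷_ (ℕP.+-cancelˡ-≡ z x y (VecP.∷-injectiveˡ e)) (+ᵥ-cancelˡ a (VecP.∷-injectiveʳ e))

+ᵥ-divides? : ∀ {k} (a m : Vec ℕ k) → (Σ (Vec ℕ k) λ x → m ≡ a +ᵥ x) ⊎ (∀ x → m ≢ a +ᵥ x)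
+ᵥ-divides? []       []       = inj₁ ([] , refl)
+ᵥ-divides? (a ∷ as) (m ∷ ms) with a ℕP.≤? m | +ᵥ-divides? as ms
... | yes a≤m | inj₁ (x , e) = inj₁ ((m ∸ a) ∷ x , cong₂ _∷_ (sym (ℕP.m+[n∸m]≡n a≤m)) e)
... | yes _   | inj₂ ∤      = inj₂ λ { (x ∷ xs) e → ∤ xs (VecP.∷-injectiveʳ e) }
... | no a≰m  | _            = inj₂ λ { (x ∷ xs) e →
  a≰m (subst (a ≤_) (sym (VecP.∷-injectiveˡ e)) (ℕP.m≤m+n a x)) }

·M-cancelˡ : ∀ {k} (x : Mono k) {y z} → x ·M y ≡ x ·M z → y ≡ z
·M-cancelˡ (a , b) e = cong₂ _,_ (+ᵥ-cancelˡ a (cong proj₁ e)) (+ᵥ-cancelˡ b (cong proj₂ e))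

·M-divides? : ∀ {k} (x m : Mono k) → (Σ (Mono k) λ y → m ≡ x ·M y) ⊎ (∀ y → m ≢ x ·M y)
·M-divides? (a , b) (ma , mb) with +ᵥ-divides? a ma | +ᵥ-divides? b mb
... | inj₁ (y₁ , e₁) | inj₁ (y₂ , e₂) = inj₁ ((y₁ , y₂) , cong₂ _,_ e₁ e₂)
... | inj₂ ∤         | _              = inj₂ λ { (y₁ , y₂) e → ∤ y₁ (cong proj₁ e) }
... | inj₁ _         | inj₂ ∤         = inj₂ λ { (y₁ , y₂) e → ∤ y₂ (cong proj₂ e) }

-- Multiplying by the term c·x is injective on monomials, so only the
-- coefficient of m/x survives.
lsum-·T-divides : ∀ {k} c (x : Mono k) (q : Poly k) m →
  lsum (λ t′ → termCoeff ((c , x) ·T t′) (x ·M m)) q ≡ c * coeff q m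
lsum-·T-divides c x q m =
  trans (lsum-cong term q) (trans (lsum-*ˡ c _ q) (cong (c *_) (sym (coeff-lsum q m))))
  where
  term : ∀ t′ → termCoeff ((c , x) ·T t′) (x ·M m) ≡ c * termCoeff t′ m
  term (d , m′) with m′ ≟M m
  ... | yes refl = trans (termCoeff-≡ (c * d) (x ·M m′)) (cong (c *_) (sym (termCoeff-≡ d m′)))
  ... | no m′≢m  = trans (termCoeff-≢ (c * d) (m′≢m ∘ ·M-cancelˡ x))
                     (trans (sym (ℚP.*-zeroʳ c)) (cong (c *_) (sym (termCoeff-≢ d m′≢m))))

lsum-·T-∤ : ∀ {k} c (x : Mono k) (q : Poly k) m → (∀ y → m ≢ x ·M y) →
  lsum (λ t′ → termCoeff ((c , x) ·T t′) m) q ≡ 0ℚ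
lsum-·T-∤ c x q m ∤ = lsum-0 _ (λ { (d , m′) → termCoeff-≢ (c * d) (λ e → ∤ m′ (sym e)) }) q

*P-congʳ : ∀ {k} (p : Poly k) {q q′ : Poly k} → q ≋ q′ → p *P q ≋ p *P q′
*P-congʳ p {q} {q′} e = ≈⇒≋ λ m →
  trans (coeff-*P p q m) (trans (lsum-cong (inner m) p) (sym (coeff-*P p q′ m)))
  where
  inner : ∀ m t → lsum (λ t′ → termCoeff (t ·T t′) m) q ≡ lsum (λ t′ → termCoeff (t ·T t′) m) q′
  inner m (c , x) with ·M-divides? x m
  ... | inj₁ (m₀ , refl) = trans (lsum-·T-divides c x q m₀)
                             (trans (cong (c *_) (≋⇒≈ e m₀)) (sym (lsum-·T-divides c x q′ m₀)))
  ... | inj₂ ∤           = trans (lsum-·T-∤ c x q m ∤) (sym (lsum-·T-∤ c x q′ m ∤))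

*P-comm : ∀ {k} (p q : Poly k) → p *P q ≋ q *P p
*P-comm p q = ≈⇒≋ λ m → begin
  coeff (p *P q) m                                      ≡⟨ coeff-*P p q m ⟩
  lsum (λ t → lsum (λ t′ → termCoeff (t ·T t′) m) q) p  ≡⟨ lsum-comm _ p q ⟩
  lsum (λ t′ → lsum (λ t → termCoeff (t ·T t′) m) p) q  ≡⟨ lsum-cong (λ t′ → lsum-cong (swap m t′) p) q ⟩
  lsum (λ t′ → lsum (λ t → termCoeff (t′ ·T t) m) p) q  ≡⟨ sym (coeff-*P q p m) ⟩
  coeff (q *P p) m                                      ∎
  where
  open ≡-Reasoning
  swap : ∀ m t′ t → termCoeff (t ·T t′) m ≡ termCoeff (t′ ·T t) m
  swap m (d , y) (c , x) = termCoeff-cong m (ℚP.*-comm c d) (·M-comm x y)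

*P-congˡ : ∀ {k} {p p′ : Poly k} (q : Poly k) → p ≋ p′ → p *P q ≋ p′ *P q
*P-congˡ {p = p} {p′} q e = ≋-trans (*P-comm p q) (≋-trans (*P-congʳ q e) (*P-comm q p′))

*P-cong : ∀ {k} {p p′ q q′ : Poly k} → p ≋ p′ → q ≋ q′ → p *P q ≋ p′ *P q′
*P-cong {p′ = p′} {q = q} e f = ≋-trans (*P-congˡ q e) (*P-congʳ p′ f)

*P-distribʳ : ∀ {k} (p p′ q : Poly k) → (p +P p′) *P q ≋ p *P q +P p′ *P q
*P-distribʳ p p′ q = ≈⇒≋ λ m → begin
  coeff ((p +P p′) *P q) m              ≡⟨ coeff-*P (p +P p′) q m ⟩
  lsum (inner m) (p +P p′)              ≡⟨ lsum-++ (inner m) p p′ ⟩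
  lsum (inner m) p + lsum (inner m) p′  ≡⟨ sym (cong₂ _+_ (coeff-*P p q m) (coeff-*P p′ q m)) ⟩
  coeff (p *P q) m + coeff (p′ *P q) m  ≡⟨ sym (coeff-+P (p *P q) (p′ *P q) m) ⟩
  coeff (p *P q +P p′ *P q) m           ∎
  where
  open ≡-Reasoning
  inner : Mono _ → Term _ → ℚ
  inner m t = lsum (λ t′ → termCoeff (t ·T t′) m) q

*P-distribˡ : ∀ {k} (p q q′ : Poly k) → p *P (q +P q′) ≋ p *P q +P p *P q′
*P-distribˡ p q q′ = ≋-trans (*P-comm p (q +P q′))
  (≋-trans (*P-distribʳ q q′ p) (+P-cong (*P-comm q p) (*P-comm q′ p)))

*P-scaleʳ : ∀ {k} c (p q : Poly k) → p *P scale c q ≋ scale c (p *P q)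
*P-scaleʳ c p q = ≈⇒≋ λ m → begin
  coeff (p *P scale c q) m
    ≡⟨ coeff-*P p (scale c q) m ⟩
  lsum (λ t → lsum (λ t′ → termCoeff (t ·T t′) m) (scale c q)) p
    ≡⟨ lsum-cong (λ t → trans (lsum-map _ _ q) (lsum-cong (pull m t) q)) p ⟩
  lsum (λ t → lsum (λ t′ → c * termCoeff (t ·T t′) m) q) p
    ≡⟨ trans (lsum-cong (λ t → lsum-*ˡ c _ q) p) (lsum-*ˡ c _ p) ⟩
  c * lsum (λ t → lsum (λ t′ → termCoeff (t ·T t′) m) q) p
    ≡⟨ cong (c *_) (sym (coeff-*P p q m)) ⟩
  c * coeff (p *P q) m
    ≡⟨ sym (coeff-scale c (p *P q) m) ⟩
  coeff (scale c (p *P q)) m ∎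
  where
  open ≡-Reasoning
  pull : ∀ m t t′ → termCoeff (t ·T (c * proj₁ t′ , proj₂ t′)) m ≡ c * termCoeff (t ·T t′) m
  pull m (a , x) (d , y) =
    trans (termCoeff-cong {m₁ = x ·M y} m (solve 3 (λ a c d → a :* (c :* d) := c :* (a :* d)) refl a c d) refl)
          (termCoeff-*ˡ c (a * d) (x ·M y) m)

*P-scaleˡ : ∀ {k} c (p q : Poly k) → scale c p *P q ≋ scale c (p *P q)
*P-scaleˡ c p q = ≋-trans (*P-comm (scale c p) q) (≋-trans (*P-scaleʳ c q p) (scale-cong c (*P-comm q p)))

*P-identityˡ : ∀ {k} (q : Poly k) → 1P *P q ≋ q
*P-identityˡ {k} q = ≈⇒≋ λ m → begin
  coeff (1P *P q) m                             ≡⟨ coeff-*P 1P q m ⟩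
  lsum (λ t′ → termCoeff (one ·T t′) m) q + 0ℚ  ≡⟨ ℚP.+-identityʳ _ ⟩
  lsum (λ t′ → termCoeff (one ·T t′) m) q       ≡⟨ lsum-cong (unit m) q ⟩
  lsum (λ t → termCoeff t m) q                  ≡⟨ sym (coeff-lsum q m) ⟩
  coeff q m                                     ∎
  where
  open ≡-Reasoning
  one : Term k
  one = (1ℚ , Vec.replicate k 0 , Vec.replicate k 0)
  unit : ∀ m t → termCoeff (one ·T t) m ≡ termCoeff t m
  unit m (d , a , b) = termCoeff-cong m (ℚP.*-identityˡ d) (cong₂ _,_ (+ᵥ-identityˡ a) (+ᵥ-identityˡ b))

*P-zeroʳ : ∀ {k} (p : Poly k) {q : Poly k} → q ≋ 0P → p *P q ≋ 0P
*P-zeroʳ p e = ≋-trans (*P-congʳ p e) (≈⇒≋ λ m → trans (coeff-*P p [] m) (lsum-0 _ (λ _ → refl) p))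

∑P : ∀ {k n} → (Fin n → Poly k) → Poly k
∑P h = sumP (tabulate h)

coeff-∑P : ∀ {k n} (h : Fin n → Poly k) m → coeff (∑P h) m ≡ ∑ (λ i → coeff (h i) m)
coeff-∑P {n = zero}  h m = refl
coeff-∑P {n = suc n} h m =
  trans (coeff-+P (h zero) (∑P (h ∘ suc)) m) (cong (coeff (h zero) m +_) (coeff-∑P (h ∘ suc) m))

∑P-cong : ∀ {k n} {h h′ : Fin n → Poly k} → (∀ i → h i ≋ h′ i) → ∑P h ≋ ∑P h′
∑P-cong {h = h} {h′} e = ≈⇒≋ λ m →
  trans (coeff-∑P h m) (trans (sum-cong-≗ (λ i → ≋⇒≈ (e i) m)) (sym (coeff-∑P h′ m)))

∑P-zero : ∀ {k n} (h : Fin n → Poly k) → (∀ i → h i ≋ 0P) → ∑P h ≋ 0P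
∑P-zero h e = ≈⇒≋ λ m → trans (coeff-∑P h m) (∑-0 _ (λ i → ≋⇒≈ (e i) m))

∑P-+P : ∀ {k n} (h h′ : Fin n → Poly k) → ∑P (λ i → h i +P h′ i) ≋ ∑P h +P ∑P h′
∑P-+P h h′ = ≈⇒≋ λ m → begin
  coeff (∑P (λ i → h i +P h′ i)) m                    ≡⟨ coeff-∑P (λ i → h i +P h′ i) m ⟩
  ∑ (λ i → coeff (h i +P h′ i) m)                     ≡⟨ sum-cong-≗ (λ i → coeff-+P (h i) (h′ i) m) ⟩
  ∑ (λ i → coeff (h i) m + coeff (h′ i) m)            ≡⟨ ∑-distrib-+ (λ i → coeff (h i) m) (λ i → coeff (h′ i) m) ⟩
  ∑ (λ i → coeff (h i) m) + ∑ (λ i → coeff (h′ i) m)  ≡⟨ sym (cong₂ _+_ (coeff-∑P h m) (coeff-∑P h′ m)) ⟩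
  coeff (∑P h) m + coeff (∑P h′) m                    ≡⟨ sym (coeff-+P (∑P h) (∑P h′) m) ⟩
  coeff (∑P h +P ∑P h′) m                             ∎
  where open ≡-Reasoning

∑P-scale : ∀ {k n} c (h : Fin n → Poly k) → ∑P (λ i → scale c (h i)) ≋ scale c (∑P h)
∑P-scale c h = ≈⇒≋ λ m → begin
  coeff (∑P (λ i → scale c (h i))) m  ≡⟨ coeff-∑P (λ i → scale c (h i)) m ⟩
  ∑ (λ i → coeff (scale c (h i)) m)   ≡⟨ sum-cong-≗ (λ i → coeff-scale c (h i) m) ⟩
  ∑ (λ i → c * coeff (h i) m)         ≡⟨ sym (*-distribˡ-sum c (λ i → coeff (h i) m)) ⟩
  c * ∑ (λ i → coeff (h i) m)         ≡⟨ cong (c *_) (sym (coeff-∑P h m)) ⟩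
  c * coeff (∑P h) m                  ≡⟨ sym (coeff-scale c (∑P h) m) ⟩
  coeff (scale c (∑P h)) m            ∎
  where open ≡-Reasoning

∑P-*Pʳ : ∀ {k n} (h : Fin n → Poly k) q → ∑P h *P q ≋ ∑P (λ i → h i *P q)
∑P-*Pʳ {n = zero}  h q = ≋-refl
∑P-*Pʳ {n = suc n} h q = ≋-trans (*P-distribʳ (h zero) (∑P (h ∘ suc)) q) (+P-cong ≋-refl (∑P-*Pʳ (h ∘ suc) q))

∑P-*Pˡ : ∀ {k n} p (h : Fin n → Poly k) → p *P ∑P h ≋ ∑P (λ i → p *P h i)
∑P-*Pˡ {n = zero}  p h = *P-zeroʳ p ≋-refl
∑P-*Pˡ {n = suc n} p h = ≋-trans (*P-distribˡ p (h zero) (∑P (h ∘ suc))) (+P-cong ≋-refl (∑P-*Pˡ p (h ∘ suc)))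

-- Partial derivatives

data Axis : Set where
  X Y : Axis

exps : ∀ {k} → Axis → Mono k → Vec ℕ k
exps X = proj₁
exps Y = proj₂

over : ∀ {k} → Axis → (Vec ℕ k → Vec ℕ k) → Mono k → Mono k
over X f (a , b) = (f a , b)
over Y f (a , b) = (a , f b)

∂ : ∀ {k} → Axis → Fin k → Poly k → Poly k
∂ X = ∂x
∂ Y = ∂y

raise lower : ∀ {k} → Axis → Fin k → Mono k → Mono k
raise ax i = over ax (λ v → updateAt v i suc)
lower ax i = over ax (λ v → updateAt v i pred)

∂T : ∀ {k} → Axis → Fin k → Term k → Term k
∂T ax i (c , m) = (c * ℕtoℚ (lookup (exps ax m) i) , lower ax i m)

∂-map : ∀ {k} ax (i : Fin k) p → ∂ ax i p ≡ List.map (∂T ax i) p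
∂-map X i p = refl
∂-map Y i p = refl

lower-raise : ∀ {k} ax (i : Fin k) m → lower ax i (raise ax i m) ≡ m
lower-raise X i (a , b) = cong (_, b) (trans (VecP.updateAt-updateAt i a) (VecP.updateAt-id i a))
lower-raise Y i (a , b) = cong (a ,_) (trans (VecP.updateAt-updateAt i b) (VecP.updateAt-id i b))

raise-lower : ∀ {k} ax (i : Fin k) m {e} → lookup (exps ax m) i ≡ suc e → raise ax i (lower ax i m) ≡ m
raise-lower X i (a , b) eq =
  cong (_, b) (trans (VecP.updateAt-updateAt i a) (VecP.updateAt-id-local i a (trans (cong (ℕ.suc ∘ pred) eq) (sym eq))))
raise-lower Y i (a , b) eq =
  cong (a ,_) (trans (VecP.updateAt-updateAt i b) (VecP.updateAt-id-local i b (trans (cong (ℕ.suc ∘ pred) eq) (sym eq))))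

lookup-raise : ∀ {k} ax (i : Fin k) m → lookup (exps ax (raise ax i m)) i ≡ suc (lookup (exps ax m) i)
lookup-raise X i (a , b) = VecP.lookup∘updateAt i a
lookup-raise Y i (a , b) = VecP.lookup∘updateAt i b

∂-weight : ∀ {k} → Axis → Fin k → Mono k → ℚ
∂-weight ax i m = ℕtoℚ (suc (lookup (exps ax m) i))

∂T-coeff : ∀ {k} ax (i : Fin k) t m →
  termCoeff (∂T ax i t) m ≡ ∂-weight ax i m * termCoeff t (raise ax i m)
∂T-coeff ax i (c , m′) m with m′ ≟M raise ax i m
... | yes refl = begin
  termCoeff (∂T ax i (c , raise ax i m)) m
    ≡⟨ termCoeff-cong m (cong (λ e → c * ℕtoℚ e) (lookup-raise ax i m)) (lower-raise ax i m) ⟩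
  termCoeff (c * ℕtoℚ (suc (lookup (exps ax m) i)) , m) m
    ≡⟨ trans (termCoeff-≡ _ m) (ℚP.*-comm c _) ⟩
  ∂-weight ax i m * c
    ≡⟨ cong (∂-weight ax i m *_) (sym (termCoeff-≡ c (raise ax i m))) ⟩
  ∂-weight ax i m * termCoeff (c , raise ax i m) (raise ax i m) ∎
  where open ≡-Reasoning
... | no m′≢raise = trans vanish (sym (trans (cong (w *_) (termCoeff-≢ c m′≢raise)) (ℚP.*-zeroʳ w)))
  where
  vanish : termCoeff (∂T ax i (c , m′)) m ≡ 0ℚ
  vanish with lookup (exps ax m′) i in eq
  ... | zero  = trans (termCoeff-cong m (ℚP.*-zeroʳ c) refl) (termCoeff-0 _ m)
  ... | suc _ = termCoeff-≢ _ λ e → m′≢raise (trans (sym (raise-lower ax i m′ eq)) (cong (raise ax i) e))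
  w : ℚ
  w = ∂-weight ax i m

coeff-∂ : ∀ {k} ax (i : Fin k) p m → coeff (∂ ax i p) m ≡ ∂-weight ax i m * coeff p (raise ax i m)
coeff-∂ ax i p m rewrite ∂-map ax i p = begin
  coeff (List.map (∂T ax i) p) m                 ≡⟨ coeff-map (∂T ax i) p m ⟩
  lsum (λ t → termCoeff (∂T ax i t) m) p         ≡⟨ lsum-cong (λ t → ∂T-coeff ax i t m) p ⟩
  lsum (λ t → w * termCoeff t (raise ax i m)) p  ≡⟨ lsum-*ˡ w _ p ⟩
  w * lsum (λ t → termCoeff t (raise ax i m)) p  ≡⟨ cong (w *_) (sym (coeff-lsum p (raise ax i m))) ⟩
  w * coeff p (raise ax i m)                     ∎
  where
  open ≡-Reasoning
  w : ℚ
  w = ∂-weight ax i m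

∂-cong : ∀ {k} ax (i : Fin k) {p q} → p ≋ q → ∂ ax i p ≋ ∂ ax i q
∂-cong ax i {p} {q} e = ≈⇒≋ λ m →
  trans (coeff-∂ ax i p m) (trans (cong (∂-weight ax i m *_) (≋⇒≈ e (raise ax i m))) (sym (coeff-∂ ax i q m)))

∂-+P : ∀ {k} ax (i : Fin k) p q → ∂ ax i (p +P q) ≋ ∂ ax i p +P ∂ ax i q
∂-+P ax i p q rewrite ∂-map ax i (p +P q) | ∂-map ax i p | ∂-map ax i q = ≡⇒≋ (ListP.map-++ (∂T ax i) p q)

∂-scale : ∀ {k} ax (i : Fin k) c p → ∂ ax i (scale c p) ≋ scale c (∂ ax i p)
∂-scale ax i c p = ≈⇒≋ λ m → begin
  coeff (∂ ax i (scale c p)) m            ≡⟨ coeff-∂ ax i (scale c p) m ⟩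
  w m * coeff (scale c p) (raise ax i m)  ≡⟨ cong (w m *_) (coeff-scale c p (raise ax i m)) ⟩
  w m * (c * coeff p (raise ax i m))      ≡⟨ solve 3 (λ w c x → w :* (c :* x) := c :* (w :* x)) refl (w m) c _ ⟩
  c * (w m * coeff p (raise ax i m))      ≡⟨ cong (c *_) (sym (coeff-∂ ax i p m)) ⟩
  c * coeff (∂ ax i p) m                  ≡⟨ sym (coeff-scale c (∂ ax i p) m) ⟩
  coeff (scale c (∂ ax i p)) m            ∎
  where
  open ≡-Reasoning
  w : Mono _ → ℚ
  w = ∂-weight ax i

∂-1P : ∀ {k} ax (i : Fin k) → ∂ ax i 1P ≋ 0P
∂-1P {k} ax i = ≈⇒≋ λ m → begin
  coeff (∂ ax i 1P) m
    ≡⟨ trans (cong (λ p → coeff p m) (∂-map ax i 1P)) (coeff-map (∂T ax i) 1P m) ⟩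
  termCoeff (∂T ax i one) m + 0ℚ
    ≡⟨ ℚP.+-identityʳ _ ⟩
  termCoeff (∂T ax i one) m
    ≡⟨ termCoeff-cong m (cong (λ e → 1ℚ * ℕtoℚ e) (exps-one ax)) refl ⟩
  termCoeff (1ℚ * ℕtoℚ 0 , lower ax i (proj₂ one)) m
    ≡⟨ termCoeff-0 _ m ⟩
  0ℚ ∎
  where
  open ≡-Reasoning
  one : Term k
  one = (1ℚ , replicate k 0 , replicate k 0)
  exps-one : ∀ ax → lookup (exps ax (proj₂ one)) i ≡ 0
  exps-one X = VecP.lookup-replicate i 0
  exps-one Y = VecP.lookup-replicate i 0

exps-·M : ∀ {k} ax (m m′ : Mono k) → exps ax (m ·M m′) ≡ exps ax m +ᵥ exps ax m′
exps-·M X m m′ = refl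
exps-·M Y m m′ = refl

updateAt-pred-+ᵥˡ : ∀ {k} (i : Fin k) (a a′ : Vec ℕ k) {e} → lookup a i ≡ suc e →
  updateAt (a +ᵥ a′) i pred ≡ updateAt a i pred +ᵥ a′
updateAt-pred-+ᵥˡ zero    (x ∷ a) (y ∷ a′) refl = refl
updateAt-pred-+ᵥˡ (suc i) (x ∷ a) (y ∷ a′) eq   = cong (x ℕ.+ y ∷_) (updateAt-pred-+ᵥˡ i a a′ eq)

updateAt-pred-+ᵥʳ : ∀ {k} (i : Fin k) (a a′ : Vec ℕ k) {e} → lookup a′ i ≡ suc e →
  updateAt (a +ᵥ a′) i pred ≡ a +ᵥ updateAt a′ i pred
updateAt-pred-+ᵥʳ zero    (x ∷ a) (y ∷ a′) {e} refl = cong (_∷ a +ᵥ a′) (cong pred (ℕP.+-suc x e))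
updateAt-pred-+ᵥʳ (suc i) (x ∷ a) (y ∷ a′) eq     = cong (x ℕ.+ y ∷_) (updateAt-pred-+ᵥʳ i a a′ eq)

lower-·Mˡ : ∀ {k} ax (i : Fin k) m m′ {e} → lookup (exps ax m) i ≡ suc e → lower ax i (m ·M m′) ≡ lower ax i m ·M m′
lower-·Mˡ X i (a , b) (a′ , b′) eq = cong (_, b +ᵥ b′) (updateAt-pred-+ᵥˡ i a a′ eq)
lower-·Mˡ Y i (a , b) (a′ , b′) eq = cong (a +ᵥ a′ ,_) (updateAt-pred-+ᵥˡ i b b′ eq)

lower-·Mʳ : ∀ {k} ax (i : Fin k) m m′ {e} → lookup (exps ax m′) i ≡ suc e → lower ax i (m ·M m′) ≡ m ·M lower ax i m′
lower-·Mʳ X i (a , b) (a′ , b′) eq = cong (_, b +ᵥ b′) (updateAt-pred-+ᵥʳ i a a′ eq)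
lower-·Mʳ Y i (a , b) (a′ , b′) eq = cong (a +ᵥ a′ ,_) (updateAt-pred-+ᵥʳ i b b′ eq)

∂T-·T : ∀ {k} ax (i : Fin k) t t′ m →
  termCoeff (∂T ax i (t ·T t′)) m ≡ termCoeff (∂T ax i t ·T t′) m + termCoeff (t ·T ∂T ax i t′) m
∂T-·T ax i (c , x) (d , y) m = begin
  termCoeff (c * d * ℕtoℚ (lookup (exps ax (x ·M y)) i) , lower ax i (x ·M y)) m
    ≡⟨ termCoeff-cong m weight refl ⟩
  termCoeff (u + v , lower ax i (x ·M y)) m
    ≡⟨ termCoeff-+ u v _ m ⟩
  termCoeff (u , lower ax i (x ·M y)) m + termCoeff (v , lower ax i (x ·M y)) m
    ≡⟨ cong₂ _+_ (termCoeff-0-or-≡ m left) (termCoeff-0-or-≡ m right) ⟩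
  termCoeff (u , lower ax i x ·M y) m + termCoeff (v , x ·M lower ax i y) m ∎
  where
  open ≡-Reasoning
  e₁ e₂ : ℕ
  e₁ = lookup (exps ax x) i
  e₂ = lookup (exps ax y) i
  u v : ℚ
  u = c * ℕtoℚ e₁ * d
  v = c * (d * ℕtoℚ e₂)
  weight : c * d * ℕtoℚ (lookup (exps ax (x ·M y)) i) ≡ u + v
  weight rewrite exps-·M ax x y | VecP.lookup-zipWith ℕ._+_ i (exps ax x) (exps ax y) | ℕtoℚ-+ e₁ e₂ =
    solve 4 (λ c d x y → c :* d :* (x :+ y) := c :* x :* d :+ c :* (d :* y)) refl c d (ℕtoℚ e₁) (ℕtoℚ e₂)
  left : lower ax i (x ·M y) ≡ lower ax i x ·M y ⊎ u ≡ 0ℚ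
  left with lookup (exps ax x) i in eq
  ... | zero  = inj₂ (trans (cong (_* d) (ℚP.*-zeroʳ c)) (ℚP.*-zeroˡ d))
  ... | suc _ = inj₁ (lower-·Mˡ ax i x y eq)
  right : lower ax i (x ·M y) ≡ x ·M lower ax i y ⊎ v ≡ 0ℚ
  right with lookup (exps ax y) i in eq
  ... | zero  = inj₂ (trans (cong (c *_) (ℚP.*-zeroʳ d)) (ℚP.*-zeroʳ c))
  ... | suc _ = inj₁ (lower-·Mʳ ax i x y eq)

∂-*P : ∀ {k} ax (i : Fin k) p q → ∂ ax i (p *P q) ≋ ∂ ax i p *P q +P p *P ∂ ax i q
∂-*P ax i p q rewrite ∂-map ax i (p *P q) | ∂-map ax i p | ∂-map ax i q = ≈⇒≋ λ m → begin
  coeff (List.map D (p *P q)) m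
    ≡⟨ trans (coeff-map D (p *P q) m) (lsum-concatMap _ (λ t → List.map (t ·T_) q) p) ⟩
  lsum (λ t → lsum (λ t″ → termCoeff (D t″) m) (List.map (t ·T_) q)) p
    ≡⟨ lsum-cong (λ t → trans (lsum-map _ (t ·T_) q) (lsum-cong (λ t′ → ∂T-·T ax i t t′ m) q)) p ⟩
  lsum (λ t → lsum (λ t′ → termCoeff (D t ·T t′) m + termCoeff (t ·T D t′) m) q) p
    ≡⟨ trans (lsum-cong (λ t → lsum-+ _ _ q) p) (lsum-+ _ _ p) ⟩
  lsum (λ t → lsum (λ t′ → termCoeff (D t ·T t′) m) q) p + lsum (λ t → lsum (λ t′ → termCoeff (t ·T D t′) m) q) p
    ≡⟨ cong₂ _+_ (sym (lsum-map (λ t → lsum (λ t′ → termCoeff (t ·T t′) m) q) D p))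
                  (lsum-cong (λ t → sym (lsum-map (λ t′ → termCoeff (t ·T t′) m) D q)) p) ⟩
  lsum (λ t → lsum (λ t′ → termCoeff (t ·T t′) m) q) (List.map D p) +
  lsum (λ t → lsum (λ t′ → termCoeff (t ·T t′) m) (List.map D q)) p
    ≡⟨ sym (cong₂ _+_ (coeff-*P (List.map D p) q m) (coeff-*P p (List.map D q) m)) ⟩
  coeff (List.map D p *P q) m + coeff (p *P List.map D q) m
    ≡⟨ sym (coeff-+P (List.map D p *P q) _ m) ⟩
  coeff (List.map D p *P q +P p *P List.map D q) m ∎
  where
  open ≡-Reasoning
  D : Term _ → Term _
  D = ∂T ax i

_≟A_ : (a b : Axis) → Dec (a ≡ b)
X ≟A X = yes refl
X ≟A Y = no λ ()
Y ≟A X = no λ ()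
Y ≟A Y = yes refl

raise-comm : ∀ {k} a (i : Fin k) b j m → raise a i (raise b j m) ≡ raise b j (raise a i m)
raise-comm X i X j (a , b) with i Fin.≟ j
... | yes refl = refl
... | no i≢j   = cong (_, b) (VecP.updateAt-commutes i j i≢j a)
raise-comm Y i Y j (a , b) with i Fin.≟ j
... | yes refl = refl
... | no i≢j   = cong (a ,_) (VecP.updateAt-commutes i j i≢j b)
raise-comm X i Y j m = refl
raise-comm Y i X j m = refl

lookup-raise-≢ : ∀ {k} a (i : Fin k) b j m → (a , i) ≢ (b , j) →
  lookup (exps b (raise a i m)) j ≡ lookup (exps b m) j
lookup-raise-≢ X i X j (a , b) ne = VecP.lookup∘updateAt′ j i (λ j≡i → ne (cong (X ,_) (sym j≡i))) a
lookup-raise-≢ Y i Y j (a , b) ne = VecP.lookup∘updateAt′ j i (λ j≡i → ne (cong (Y ,_) (sym j≡i))) b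
lookup-raise-≢ X i Y j m ne = refl
lookup-raise-≢ Y i X j m ne = refl

∂-comm : ∀ {k} a (i : Fin k) b j p → ∂ a i (∂ b j p) ≋ ∂ b j (∂ a i p)
∂-comm a i b j p with ≡-dec _≟A_ Fin._≟_ (a , i) (b , j)
... | yes refl = ≋-refl
... | no ne    = ≈⇒≋ λ m → begin
  coeff (∂ a i (∂ b j p)) m
    ≡⟨ trans (coeff-∂ a i (∂ b j p) m) (cong (∂-weight a i m *_) (coeff-∂ b j p (raise a i m))) ⟩
  ∂-weight a i m * (∂-weight b j (raise a i m) * coeff p (raise b j (raise a i m)))
    ≡⟨ cong₂ (λ e r → ∂-weight a i m * (ℕtoℚ (suc e) * coeff p r))
             (lookup-raise-≢ a i b j m ne) (sym (raise-comm a i b j m)) ⟩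
  ∂-weight a i m * (∂-weight b j m * coeff p (raise a i (raise b j m)))
    ≡⟨ solve 3 (λ x y z → x :* (y :* z) := y :* (x :* z)) refl (∂-weight a i m) (∂-weight b j m) _ ⟩
  ∂-weight b j m * (∂-weight a i m * coeff p (raise a i (raise b j m)))
    ≡⟨ cong (λ e → ∂-weight b j m * (ℕtoℚ (suc e) * coeff p (raise a i (raise b j m))))
            (sym (lookup-raise-≢ b j a i m (ne ∘ sym))) ⟩
  ∂-weight b j m * (∂-weight a i (raise b j m) * coeff p (raise a i (raise b j m)))
    ≡⟨ sym (trans (coeff-∂ b j (∂ a i p) m) (cong (∂-weight b j m *_) (coeff-∂ a i p (raise b j m)))) ⟩
  coeff (∂ b j (∂ a i p)) m ∎
  where open ≡-Reasoning

∂-∑P : ∀ {k n} ax (j : Fin k) (h : Fin n → Poly k) → ∂ ax j (∑P h) ≋ ∑P (λ r → ∂ ax j (h r))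
∂-∑P ax j h = ≈⇒≋ λ m → begin
  coeff (∂ ax j (∑P h)) m                     ≡⟨ coeff-∂ ax j (∑P h) m ⟩
  w m * coeff (∑P h) (raise ax j m)           ≡⟨ cong (w m *_) (coeff-∑P h (raise ax j m)) ⟩
  w m * ∑ (λ r → coeff (h r) (raise ax j m))  ≡⟨ *-distribˡ-sum (w m) (λ r → coeff (h r) (raise ax j m)) ⟩
  ∑ (λ r → w m * coeff (h r) (raise ax j m))  ≡⟨ sum-cong-≗ (λ r → sym (coeff-∂ ax j (h r) m)) ⟩
  ∑ (λ r → coeff (∂ ax j (h r)) m)            ≡⟨ sym (coeff-∑P (λ r → ∂ ax j (h r)) m) ⟩
  coeff (∑P (λ r → ∂ ax j (h r))) m           ∎
  where
  open ≡-Reasoning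
  w : Mono _ → ℚ
  w = ∂-weight ax j

record IsLinear {k j} (F : Poly k → Poly j) : Set where
  field
    F-cong  : ∀ {p q} → p ≋ q → F p ≋ F q
    F-+P    : ∀ p q → F (p +P q) ≋ F p +P F q
    F-scale : ∀ c p → F (scale c p) ≋ scale c (F p)

  F-0P : F 0P ≋ 0P
  F-0P = ≋-trans (F-scale 0ℚ 0P) (scale-0ℚ (F 0P))

  F-lincomb : ∀ {m} (cs : Vec ℚ m) ds → F (lincomb cs ds) ≋ lincomb cs (Vec.map F ds)
  F-lincomb []       []       = F-0P
  F-lincomb (c ∷ cs) (d ∷ ds) = ≋-trans (F-+P (scale c d) (lincomb cs ds)) (+P-cong (F-scale c d) (F-lincomb cs ds))

record IsDerivation {k} (D : Poly k → Poly k) : Set where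
  field
    isLinear : IsLinear D
    D-*P     : ∀ p q → D (p *P q) ≋ D p *P q +P p *P D q
    D-1P     : D 1P ≋ 0P
  open IsLinear isLinear public

∂-isDerivation : ∀ {k} ax (i : Fin k) → IsDerivation (∂ ax i)
∂-isDerivation ax i = record
  { isLinear = record { F-cong = ∂-cong ax i ; F-+P = ∂-+P ax i ; F-scale = ∂-scale ax i }
  ; D-*P = ∂-*P ax i ; D-1P = ∂-1P ax i }

∂-isLinear : ∀ {k} ax (i : Fin k) → IsLinear (∂ ax i)
∂-isLinear ax i = IsDerivation.isLinear (∂-isDerivation ax i)

IsDeriv-∂ : ∀ {k} {D : Poly k} ax i {q} → IsDeriv D q → IsDeriv D (∂ ax i q)
IsDeriv-∂ X i d = dx i d
IsDeriv-∂ Y i d = dy i d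

-- The infinitesimal generator of the translations along an axis.
∂Σ : ∀ {k} → Axis → Poly k → Poly k
∂Σ ax p = ∑P (λ i → ∂ ax i p)

∂Σ-isDerivation : ∀ {k} ax → IsDerivation {k} (∂Σ ax)
∂Σ-isDerivation ax = record
  { isLinear = record
    { F-cong  = λ e → ∑P-cong (λ i → ∂-cong ax i e)
    ; F-+P    = λ p q → ≋-trans (∑P-cong (λ i → ∂-+P ax i p q)) (∑P-+P (λ i → ∂ ax i p) (λ i → ∂ ax i q))
    ; F-scale = λ c p → ≋-trans (∑P-cong (λ i → ∂-scale ax i c p)) (∑P-scale c (λ i → ∂ ax i p)) }
  ; D-*P = λ p q → ≋-trans (∑P-cong (λ i → ∂-*P ax i p q))
                    (≋-trans (∑P-+P (λ i → ∂ ax i p *P q) (λ i → p *P ∂ ax i q))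
                       (+P-cong (≋-sym (∑P-*Pʳ (λ i → ∂ ax i p) q)) (≋-sym (∑P-*Pˡ p (λ i → ∂ ax i q)))))
  ; D-1P = ∑P-zero _ (λ i → ∂-1P ax i) }

TranslationInvariant : ∀ {k} → Axis → Poly k → Set
TranslationInvariant ax p = ∂Σ ax p ≋ 0P

∂-translationInvariant : ∀ {k} ax b (j : Fin k) {q} → TranslationInvariant ax q → TranslationInvariant ax (∂ b j q)
∂-translationInvariant ax b j {q} inv = begin
  ∑P (λ r → ∂ ax r (∂ b j q))  ≈⟨ ∑P-cong (λ r → ∂-comm ax r b j q) ⟩
  ∑P (λ r → ∂ b j (∂ ax r q))  ≈⟨ ≋-sym (∂-∑P b j (λ r → ∂ ax r q)) ⟩
  ∂ b j (∂Σ ax q)              ≈⟨ ∂-cong b j inv ⟩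
  ∂ b j 0P                     ≈⟨ ≡⇒≋ (∂-map b j 0P) ⟩
  0P                           ∎
  where open ≋-Reasoning

-- Determinants with columns indexed by cells

Row : ℕ → Set
Row K = Cell → Poly K

module _ {K : ℕ} where

  -- Laplace expansion along the row f, where g r is the minor on the
  -- columns r; the sign of a term is the parity of its column position.
  expand : Row K → (List Cell → Poly K) → List Cell → Poly K
  expand f g []       = 0P
  expand f g (x ∷ xs) = f x *P g xs +P neg (expand f (g ∘ (x ∷_)) xs)

  -- Zero unless the matrix is square.
  Det : List (Row K) → List Cell → Poly K
  Det []       []      = 1P
  Det []       (_ ∷ _) = 0P
  Det (f ∷ fs)         = expand f (Det fs)

  expand-cong-on : ∀ {P : Cell → Set} {f₁ f₂ : Row K} {g₁ g₂ : List Cell → Poly K} L → All P L →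
    (∀ c → P c → f₁ c ≋ f₂ c) → (∀ r → All P r → g₁ r ≋ g₂ r) → expand f₁ g₁ L ≋ expand f₂ g₂ L
  expand-cong-on []       _          ef eg = ≋-refl
  expand-cong-on (x ∷ xs) (px ∷ pxs) ef eg =
    +P-cong (*P-cong (ef x px) (eg xs pxs)) (scale-cong -1q (expand-cong-on xs pxs ef (λ r pr → eg (x ∷ r) (px ∷ pr))))

  expand-cong : ∀ {f₁ f₂ : Row K} {g₁ g₂ : List Cell → Poly K} L →
    (∀ c → f₁ c ≋ f₂ c) → (∀ r → g₁ r ≋ g₂ r) → expand f₁ g₁ L ≋ expand f₂ g₂ L
  expand-cong L ef eg = expand-cong-on {P = λ _ → ⊤} L (All.universal _ L) (λ c _ → ef c) (λ r _ → eg r)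

  expand-zeroʳ-on : ∀ {P : Cell → Set} (f : Row K) {g : List Cell → Poly K} L → All P L →
    (∀ r → All P r → g r ≋ 0P) → expand f g L ≋ 0P
  expand-zeroʳ-on f []       _          eg = ≋-refl
  expand-zeroʳ-on f (x ∷ xs) (px ∷ pxs) eg =
    +P-cong (*P-zeroʳ (f x) (eg xs pxs)) (scale-cong -1q (expand-zeroʳ-on f xs pxs (λ r pr → eg (x ∷ r) (px ∷ pr))))

  expand-zeroˡ-on : ∀ {P : Cell → Set} {f : Row K} (g : List Cell → Poly K) L → All P L →
    (∀ c → P c → f c ≋ 0P) → expand f g L ≋ 0P
  expand-zeroˡ-on g []       _          ef = ≋-refl
  expand-zeroˡ-on g (x ∷ xs) (px ∷ pxs) ef =
    +P-cong (*P-congˡ (g xs) (ef x px)) (scale-cong -1q (expand-zeroˡ-on (g ∘ (x ∷_)) xs pxs ef))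

  expand-scale : ∀ (f : Row K) c (g : List Cell → Poly K) L → expand f (scale c ∘ g) L ≋ scale c (expand f g L)
  expand-scale f c g []       = ≋-refl
  expand-scale f c g (x ∷ xs) = begin
    f x *P scale c (g xs) +P neg (expand f (scale c ∘ g ∘ (x ∷_)) xs)
      ≈⟨ +P-cong (*P-scaleʳ c (f x) (g xs)) (scale-cong -1q (expand-scale f c (g ∘ (x ∷_)) xs)) ⟩
    scale c (f x *P g xs) +P neg (scale c (expand f (g ∘ (x ∷_)) xs))
      ≈⟨ +P-cong ≋-refl (scale-comm -1q c (expand f (g ∘ (x ∷_)) xs)) ⟩
    scale c (f x *P g xs) +P scale c (neg (expand f (g ∘ (x ∷_)) xs))
      ≈⟨ ≋-sym (scale-+P c (f x *P g xs) (neg (expand f (g ∘ (x ∷_)) xs))) ⟩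
    scale c (expand f g (x ∷ xs)) ∎
    where open ≋-Reasoning

  expand-+P : ∀ (f : Row K) (g₁ g₂ : List Cell → Poly K) L →
    expand f (λ r → g₁ r +P g₂ r) L ≋ expand f g₁ L +P expand f g₂ L
  expand-+P f g₁ g₂ []       = ≋-refl
  expand-+P f g₁ g₂ (x ∷ xs) = begin
    f x *P (g₁ xs +P g₂ xs) +P neg (expand f (λ r → g₁ (x ∷ r) +P g₂ (x ∷ r)) xs)
      ≈⟨ +P-cong (*P-distribˡ (f x) (g₁ xs) (g₂ xs))
                 (≋-trans (scale-cong -1q (expand-+P f (g₁ ∘ (x ∷_)) (g₂ ∘ (x ∷_)) xs)) (scale-+P -1q E₁ E₂)) ⟩
    (f x *P g₁ xs +P f x *P g₂ xs) +P (neg E₁ +P neg E₂)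
      ≈⟨ +P-solve 4 (λ a b c d → (a ⊕ b) ⊕ (c ⊕ d) ⊜ (a ⊕ c) ⊕ (b ⊕ d)) ≋-refl
                    (f x *P g₁ xs) (f x *P g₂ xs) (neg E₁) (neg E₂) ⟩
    expand f g₁ (x ∷ xs) +P expand f g₂ (x ∷ xs) ∎
    where
    open ≋-Reasoning
    E₁ E₂ : Poly K
    E₁ = expand f (g₁ ∘ (x ∷_)) xs
    E₂ = expand f (g₂ ∘ (x ∷_)) xs
    open +P-Solver using (_⊕_; _⊜_) renaming (solve to +P-solve)

  coeff-expand-∷ : ∀ (f : Row K) g x xs m →
    coeff (expand f g (x ∷ xs)) m ≡ coeff (f x *P g xs) m + ℚ.- coeff (expand f (g ∘ (x ∷_)) xs) m
  coeff-expand-∷ f g x xs m =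
    trans (coeff-+P (f x *P g xs) (neg (expand f (g ∘ (x ∷_)) xs)) m)
          (cong (coeff (f x *P g xs) m +_) (coeff-neg (expand f (g ∘ (x ∷_)) xs) m))

  Alternating : (List Cell → Poly K) → Set
  Alternating g = ∀ pre a b post → g (pre ++ a ∷ b ∷ post) ≋ neg (g (pre ++ b ∷ a ∷ post))

  expand-alternating : ∀ (f : Row K) g → Alternating g → Alternating (expand f g)
  expand-alternating f g alt-g [] a b post = ≈⇒≋ λ m → begin
    coeff (expand f g (a ∷ b ∷ post)) m
      ≡⟨ trans (coeff-expand-∷ f g a (b ∷ post) m) (cong (λ z → u m + ℚ.- z) (coeff-expand-∷ f (g ∘ (a ∷_)) b post m)) ⟩
    u m + ℚ.- (v m + ℚ.- coeff (expand f (g ∘ (a ∷_) ∘ (b ∷_)) post) m)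
      ≡⟨ cong (λ z → u m + ℚ.- (v m + ℚ.- z))
              (trans (≋⇒≈ swapped m) (coeff-neg (expand f (g ∘ (b ∷_) ∘ (a ∷_)) post) m)) ⟩
    u m + ℚ.- (v m + ℚ.- (ℚ.- l m))
      ≡⟨ solve 3 (λ u v l → u :+ :- (v :+ :- (:- l)) := :- (v :+ :- (u :+ :- l))) refl (u m) (v m) (l m) ⟩
    ℚ.- (v m + ℚ.- (u m + ℚ.- l m))
      ≡⟨ sym (trans (coeff-neg (expand f g (b ∷ a ∷ post)) m) (cong ℚ.-_ (trans (coeff-expand-∷ f g b (a ∷ post) m)
                (cong (λ z → v m + ℚ.- z) (coeff-expand-∷ f (g ∘ (b ∷_)) a post m))))) ⟩
    coeff (neg (expand f g (b ∷ a ∷ post))) m ∎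
    where
    open ≡-Reasoning
    u v l : Mono K → ℚ
    u m = coeff (f a *P g (b ∷ post)) m
    v m = coeff (f b *P g (a ∷ post)) m
    l m = coeff (expand f (g ∘ (b ∷_) ∘ (a ∷_)) post) m
    swapped : expand f (g ∘ (a ∷_) ∘ (b ∷_)) post ≋ neg (expand f (g ∘ (b ∷_) ∘ (a ∷_)) post)
    swapped = ≋-trans (expand-cong post (λ c → ≋-refl) (alt-g [] a b)) (expand-scale f -1q (g ∘ (b ∷_) ∘ (a ∷_)) post)
  expand-alternating f g alt-g (x ∷ pre) a b post = ≈⇒≋ λ m → begin
    coeff (expand f g (x ∷ (pre ++ a ∷ b ∷ post))) m
      ≡⟨ coeff-expand-∷ f g x (pre ++ a ∷ b ∷ post) m ⟩
    coeff (f x *P g (pre ++ a ∷ b ∷ post)) m + ℚ.- coeff (expand f (g ∘ (x ∷_)) (pre ++ a ∷ b ∷ post)) m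
      ≡⟨ cong₂ (λ y z → y + ℚ.- z)
               (trans (≋⇒≈ (≋-trans (*P-congʳ (f x) (alt-g pre a b post)) (*P-scaleʳ -1q (f x) (g swapped))) m)
                      (coeff-neg (f x *P g swapped) m))
               (trans (≋⇒≈ (expand-alternating f (g ∘ (x ∷_)) (alt-g ∘ (x ∷_)) pre a b post) m)
                      (coeff-neg (expand f (g ∘ (x ∷_)) swapped) m)) ⟩
    ℚ.- U m + ℚ.- (ℚ.- L m)
      ≡⟨ solve 2 (λ u l → :- u :+ :- (:- l) := :- (u :+ :- l)) refl (U m) (L m) ⟩
    ℚ.- (U m + ℚ.- L m)
      ≡⟨ sym (trans (coeff-neg (expand f g (x ∷ (pre ++ b ∷ a ∷ post))) m) (cong ℚ.-_ (coeff-expand-∷ f g x _ m))) ⟩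
    coeff (neg (expand f g (x ∷ (pre ++ b ∷ a ∷ post)))) m ∎
    where
    open ≡-Reasoning
    swapped = pre ++ b ∷ a ∷ post
    U L : Mono K → ℚ
    U m = coeff (f x *P g swapped) m
    L m = coeff (expand f (g ∘ (x ∷_)) swapped) m

  Det-alternating : ∀ fs → Alternating (Det fs)
  Det-alternating []       []        a b post = ≋-refl
  Det-alternating []       (_ ∷ pre) a b post = ≋-refl
  Det-alternating (f ∷ fs) = expand-alternating f (Det fs) (Det-alternating fs)

  alternating-duplicate : ∀ g → Alternating g → ∀ pre a mid post → g (pre ++ a ∷ (mid ++ a ∷ post)) ≋ 0P
  alternating-duplicate g alt-g pre a []        post = ≋-neg⇒≋0 (alt-g pre a a post)
  alternating-duplicate g alt-g pre a (y ∷ mid) post =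
    ≋-trans (alt-g pre a y (mid ++ a ∷ post))
      (scale-cong -1q (≋-trans (≡⇒≋ (cong g (sym (ListP.++-assoc pre [ y ] (a ∷ (mid ++ a ∷ post))))))
                             (alternating-duplicate g alt-g (pre ++ [ y ]) a mid post)))

  module _ (w : Cell → ℕ) (dn : Cell → Cell) where

    shiftSum : (List Cell → Poly K) → List Cell → Poly K
    shiftSum g []       = 0P
    shiftSum g (x ∷ xs) = scale (ℕtoℚ (w x)) (g (dn x ∷ xs)) +P shiftSum (g ∘ (x ∷_)) xs

    shiftSum-cong : ∀ {g₁ g₂ : List Cell → Poly K} L → (∀ r → g₁ r ≋ g₂ r) → shiftSum g₁ L ≋ shiftSum g₂ L
    shiftSum-cong []       e = ≋-refl
    shiftSum-cong (x ∷ xs) e = +P-cong (scale-cong (ℕtoℚ (w x)) (e (dn x ∷ xs))) (shiftSum-cong xs (e ∘ (x ∷_)))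

    shiftSum-zero : ∀ {g : List Cell → Poly K} L → (∀ r → g r ≋ 0P) → shiftSum g L ≋ 0P
    shiftSum-zero []       e = ≋-refl
    shiftSum-zero (x ∷ xs) e = +P-cong (scale-cong (ℕtoℚ (w x)) (e (dn x ∷ xs))) (shiftSum-zero xs (e ∘ (x ∷_)))

    shiftSum-scale : ∀ c (g : List Cell → Poly K) L → shiftSum (scale c ∘ g) L ≋ scale c (shiftSum g L)
    shiftSum-scale c g []       = ≋-refl
    shiftSum-scale c g (x ∷ xs) = ≋-trans
      (+P-cong (scale-comm (ℕtoℚ (w x)) c (g (dn x ∷ xs))) (shiftSum-scale c (g ∘ (x ∷_)) xs))
      (≋-sym (scale-+P c (scale (ℕtoℚ (w x)) (g (dn x ∷ xs))) (shiftSum (g ∘ (x ∷_)) xs)))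

    shiftSum-+P : ∀ (g₁ g₂ : List Cell → Poly K) L → shiftSum (λ r → g₁ r +P g₂ r) L ≋ shiftSum g₁ L +P shiftSum g₂ L
    shiftSum-+P g₁ g₂ []       = ≋-refl
    shiftSum-+P g₁ g₂ (x ∷ xs) = begin
      scale wx (g₁ (dn x ∷ xs) +P g₂ (dn x ∷ xs)) +P shiftSum (λ r → g₁ (x ∷ r) +P g₂ (x ∷ r)) xs
        ≈⟨ +P-cong (scale-+P wx (g₁ (dn x ∷ xs)) (g₂ (dn x ∷ xs))) (shiftSum-+P (g₁ ∘ (x ∷_)) (g₂ ∘ (x ∷_)) xs) ⟩
      (scale wx (g₁ (dn x ∷ xs)) +P scale wx (g₂ (dn x ∷ xs))) +P (S₁ +P S₂)
        ≈⟨ +P-solve 4 (λ a b c d → (a ⊕ b) ⊕ (c ⊕ d) ⊜ (a ⊕ c) ⊕ (b ⊕ d)) ≋-refl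
                      (scale wx (g₁ (dn x ∷ xs))) (scale wx (g₂ (dn x ∷ xs))) S₁ S₂ ⟩
      shiftSum g₁ (x ∷ xs) +P shiftSum g₂ (x ∷ xs) ∎
      where
      open ≋-Reasoning
      open +P-Solver using (_⊕_; _⊜_) renaming (solve to +P-solve)
      wx : ℚ
      wx = ℕtoℚ (w x)
      S₁ S₂ : Poly K
      S₁ = shiftSum (g₁ ∘ (x ∷_)) xs
      S₂ = shiftSum (g₂ ∘ (x ∷_)) xs

    shiftSum-*Pˡ : ∀ (h : Poly K) (g : List Cell → Poly K) L → shiftSum (λ r → h *P g r) L ≋ h *P shiftSum g L
    shiftSum-*Pˡ h g []       = ≋-sym (*P-zeroʳ h ≋-refl)
    shiftSum-*Pˡ h g (x ∷ xs) = ≋-trans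
      (+P-cong (≋-sym (*P-scaleʳ (ℕtoℚ (w x)) h (g (dn x ∷ xs)))) (shiftSum-*Pˡ h (g ∘ (x ∷_)) xs))
      (≋-sym (*P-distribˡ h (scale (ℕtoℚ (w x)) (g (dn x ∷ xs))) (shiftSum (g ∘ (x ∷_)) xs)))

    shiftSum-expand-∷ : ∀ f g x L → shiftSum (expand f g ∘ (x ∷_)) L ≋
      f x *P shiftSum g L +P neg (shiftSum (expand f (g ∘ (x ∷_))) L)
    shiftSum-expand-∷ f g x L = ≋-trans (shiftSum-+P (λ r → f x *P g r) (λ r → neg (expand f (g ∘ (x ∷_)) r)) L)
      (+P-cong (shiftSum-*Pˡ (f x) g L) (shiftSum-scale -1q (expand f (g ∘ (x ∷_))) L))

  module _ {D : Poly K → Poly K} (isD : IsDerivation D) (w : Cell → ℕ) (dn : Cell → Cell) where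
    open IsDerivation isD

    Shifted : Row K → Set
    Shifted f = ∀ c → D (f c) ≋ scale (ℕtoℚ (w c)) (f (dn c))

    -- The error term A makes the statement strong enough for induction on the columns.
    expand-derivative : ∀ {f} → Shifted f → ∀ L g A → (∀ r → D (g r) ≋ shiftSum w dn g r +P A r) →
      D (expand f g L) ≋ shiftSum w dn (expand f g) L +P expand f A L
    expand-derivative df []       g A dg = F-0P
    expand-derivative {f} df (x ∷ xs) g A dg = begin
      D (f x *P g xs +P neg E)
        ≈⟨ ≋-trans (F-+P (f x *P g xs) (neg E)) (+P-cong (D-*P (f x) (g xs)) (F-scale -1q E)) ⟩
      (D (f x) *P g xs +P f x *P D (g xs)) +P neg (D E)
        ≈⟨ +P-cong (+P-cong (≋-trans (*P-congˡ (g xs) (df x)) (*P-scaleˡ wx (f (dn x)) (g xs)))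
                            (≋-trans (*P-congʳ (f x) (dg xs)) (*P-distribˡ (f x) (shiftSum w dn g xs) (A xs))))
                   (scale-cong -1q IH) ⟩
      (scale wx α +P (γ +P ε)) +P neg (δ +P (scale wx β +P ζ))
        ≈⟨ +P-cong ≋-refl (≋-trans (scale-+P -1q δ (scale wx β +P ζ))
                                   (+P-cong ≋-refl (≋-trans (scale-+P -1q (scale wx β) ζ)
                                                            (+P-cong (scale-comm -1q wx β) ≋-refl)))) ⟩
      (scale wx α +P (γ +P ε)) +P (neg δ +P (scale wx (neg β) +P neg ζ))
        ≈⟨ +P-solve 6 (λ a b c d e z → (a ⊕ (c ⊕ e)) ⊕ (d ⊕ (b ⊕ z)) ⊜ ((a ⊕ b) ⊕ (c ⊕ d)) ⊕ (e ⊕ z)) ≋-refl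
                      (scale wx α) (scale wx (neg β)) γ (neg δ) ε (neg ζ) ⟩
      ((scale wx α +P scale wx (neg β)) +P (γ +P neg δ)) +P (ε +P neg ζ)
        ≈⟨ +P-cong (+P-cong (≋-sym (scale-+P wx α (neg β))) (≋-sym (shiftSum-expand-∷ w dn f g x xs))) ≋-refl ⟩
      shiftSum w dn (expand f g) (x ∷ xs) +P expand f A (x ∷ xs) ∎
      where
      open ≋-Reasoning
      open +P-Solver using (_⊕_; _⊜_) renaming (solve to +P-solve)
      wx : ℚ
      wx = ℕtoℚ (w x)
      E α β γ δ ε ζ : Poly K
      E = expand f (g ∘ (x ∷_)) xs
      α = f (dn x) *P g xs
      β = expand f (g ∘ (dn x ∷_)) xs
      γ = f x *P shiftSum w dn g xs
      δ = shiftSum w dn (expand f (g ∘ (x ∷_))) xs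
      ε = f x *P A xs
      ζ = expand f (A ∘ (x ∷_)) xs
      dgx : ∀ r → D (g (x ∷ r)) ≋ shiftSum w dn (g ∘ (x ∷_)) r +P (scale wx (g (dn x ∷ r)) +P A (x ∷ r))
      dgx r = ≋-trans (dg (x ∷ r))
        (+P-solve 3 (λ a b c → (a ⊕ b) ⊕ c ⊜ b ⊕ (a ⊕ c)) ≋-refl
                    (scale wx (g (dn x ∷ r))) (shiftSum w dn (g ∘ (x ∷_)) r) (A (x ∷ r)))
      IH : D E ≋ δ +P (scale wx β +P ζ)
      IH = ≋-trans (expand-derivative df xs (g ∘ (x ∷_)) (λ r → scale wx (g (dn x ∷ r)) +P A (x ∷ r)) dgx)
        (+P-cong ≋-refl (≋-trans (expand-+P f (scale wx ∘ g ∘ (dn x ∷_)) (A ∘ (x ∷_)) xs)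
                                 (+P-cong (expand-scale f wx (g ∘ (dn x ∷_)) xs) ≋-refl)))

    Det-derivative : ∀ fs → All Shifted fs → ∀ L → D (Det fs L) ≋ shiftSum w dn (Det fs) L
    Det-derivative []       []       []       = D-1P
    Det-derivative []       []       (x ∷ xs) = ≋-trans F-0P (≋-sym (shiftSum-zero w dn xs (λ r → ≋-refl)))
    Det-derivative (f ∷ fs) (df ∷ dfs) L = begin
      D (expand f (Det fs) L)
        ≈⟨ expand-derivative df L (Det fs) (λ _ → 0P)
             (λ r → ≋-trans (Det-derivative fs dfs r) (≋-sym (+P-identityʳ (shiftSum w dn (Det fs) r)))) ⟩
      shiftSum w dn (expand f (Det fs)) L +P expand f (λ _ → 0P) L
        ≈⟨ +P-cong ≋-refl (expand-zeroʳ-on {P = λ _ → ⊤} f L (All.universal _ L) (λ _ _ → ≋-refl)) ⟩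
      shiftSum w dn (expand f (Det fs)) L +P 0P
        ≈⟨ +P-identityʳ _ ⟩
      shiftSum w dn (Det (f ∷ fs)) L ∎
      where open ≋-Reasoning

  -- Each term of the shift sum repeats a column, unless its weight vanishes.
  shiftSum-closed : ∀ (w : Cell → ℕ) dn → (∀ c → w c ≢ 0 → dn c ≢ c) → ∀ g → Alternating g →
    ∀ pre L → (∀ c → c ∈ L → w c ≢ 0 → dn c ∈ pre ++ L) → shiftSum w dn (g ∘ (pre ++_)) L ≋ 0P
  shiftSum-closed w dn moves g alt-g pre []       closed = ≋-refl
  shiftSum-closed w dn moves g alt-g pre (x ∷ xs) closed = +P-cong first rest
    where
    first : scale (ℕtoℚ (w x)) (g (pre ++ dn x ∷ xs)) ≋ 0P
    first with w x ℕ.≟ 0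
    ... | yes w≡0 = ≋-trans (≡⇒≋ (cong (λ e → scale (ℕtoℚ e) (g (pre ++ dn x ∷ xs))) w≡0)) (scale-0ℚ _)
    ... | no w≢0 with ∈-++⁻ pre (closed x (here refl) w≢0)
    ...   | inj₁ ∈pre with ∈-∃++ ∈pre
    ...     | A , B , refl = scale-cong (ℕtoℚ (w x))
      (≋-trans (≡⇒≋ (cong g (ListP.++-assoc A (dn x ∷ B) (dn x ∷ xs)))) (alternating-duplicate g alt-g A (dn x) B xs))
    first | no w≢0 | inj₂ (here dn≡x) = ⊥-elim (moves x w≢0 dn≡x)
    first | no w≢0 | inj₂ (there ∈xs) with ∈-∃++ ∈xs
    ...     | A , B , refl = scale-cong (ℕtoℚ (w x)) (alternating-duplicate g alt-g pre (dn x) A B)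
    rest : shiftSum w dn (g ∘ (pre ++_) ∘ (x ∷_)) xs ≋ 0P
    rest = ≋-trans (shiftSum-cong w dn xs (λ r → ≡⇒≋ (cong g (sym (ListP.++-assoc pre [ x ] r)))))
      (shiftSum-closed w dn moves g alt-g (pre ++ [ x ]) xs
        (λ c c∈xs w≢0 → subst (dn c ∈_) (sym (ListP.++-assoc pre [ x ] xs)) (closed c (there c∈xs) w≢0)))

-- Δ_L as such a determinant, and its translation invariance

expand-toList : ∀ {K n} (f : Row K) (g : List Cell → Poly K) (L : Vec Cell (suc n)) →
  ∑P (λ j → scale (alt (toℕ j)) (f (lookup L j) *P g (toList (removeAt L j)))) ≋ expand f g (toList L)
expand-toList {n = zero}  f g (x ∷ []) =
  +P-cong (scale-1ℚ (f x *P g [])) ≋-refl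
expand-toList {n = suc n} f g (x ∷ xs@(_ ∷ _)) = +P-cong (scale-1ℚ (f x *P g (toList xs))) (begin
  ∑P (λ j → scale (alt (suc (toℕ j))) (term j))  ≈⟨ ∑P-cong (λ j → scale-alt-suc (toℕ j) (term j)) ⟩
  ∑P (λ j → neg (scale (alt (toℕ j)) (term j)))  ≈⟨ ∑P-scale -1q (λ j → scale (alt (toℕ j)) (term j)) ⟩
  neg (∑P (λ j → scale (alt (toℕ j)) (term j)))  ≈⟨ scale-cong -1q (expand-toList f (g ∘ (x ∷_)) xs) ⟩
  neg (expand f (g ∘ (x ∷_)) (toList xs))        ∎)
  where
  open ≋-Reasoning
  term : Fin (suc n) → Poly _
  term j = f (lookup xs j) *P g (x ∷ toList (removeAt xs j))

removeAt-map : ∀ {n} {A B : Set} (f : A → B) (xs : Vec A (suc n)) j → removeAt (Vec.map f xs) j ≡ Vec.map f (removeAt xs j)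
removeAt-map f (x ∷ xs)     zero    = refl
removeAt-map f (x ∷ y ∷ xs) (suc j) = cong (f x ∷_) (removeAt-map f (y ∷ xs) j)

det≋Det : ∀ {K N} (fs : Vec (Row K) N) (L : Vec Cell N) → det (Vec.map (λ f → Vec.map f L) fs) ≋ Det (toList fs) (toList L)
det≋Det []       []    = ≋-refl
det≋Det (f ∷ fs) L = ≋-trans
  (∑P-cong λ j → scale-cong (alt (toℕ j)) (*P-cong (≡⇒≋ (VecP.lookup-map j f L))
                                                    (≋-trans (≡⇒≋ (cong det (minor j))) (det≋Det fs (removeAt L j)))))
  (expand-toList f (Det (toList fs)) L)
  where
  minor : ∀ j → Vec.map (λ r → removeAt r j) (Vec.map (λ f → Vec.map f L) fs) ≡ Vec.map (λ f → Vec.map f (removeAt L j)) fs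
  minor j = trans (sym (VecP.map-∘ (λ r → removeAt r j) (λ f → Vec.map f L) fs)) (VecP.map-cong (λ h → removeAt-map h L j) fs)

monomialRow : ∀ {N} → Fin N → Row N
monomialRow r (p , q) = xyPow r p q

monomialRows : ∀ N → List (Row N)
monomialRows N = toList (tabulate monomialRow)

Δ≋Det : ∀ {N} (L : Vec Cell N) → Δ L ≋ scale (normalizer L) (Det (monomialRows N) (toList L))
Δ≋Det {N} L = scale-cong (normalizer L)
  (≋-trans (≡⇒≋ (cong det (VecP.tabulate-∘ (λ f → Vec.map f L) monomialRow))) (det≋Det (tabulate monomialRow) L))

All-toList-tabulate : ∀ {n} {A : Set} {P : A → Set} {h : Fin n → A} → (∀ i → P (h i)) → All P (toList (tabulate h))
All-toList-tabulate {zero}  Ph = []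
All-toList-tabulate {suc n} Ph = Ph zero ∷ All-toList-tabulate (Ph ∘ suc)

cellExp : Axis → Cell → ℕ
cellExp X = proj₁
cellExp Y = proj₂

lowerCell : Axis → Cell → Cell
lowerCell X (p , q) = (pred p , q)
lowerCell Y (p , q) = (p , pred q)

lowerCell-moves : ∀ ax c → cellExp ax c ≢ 0 → lowerCell ax c ≢ c
lowerCell-moves X (zero  , q) p≢0 _  = p≢0 refl
lowerCell-moves X (suc p , q) _   eq = ℕP.1+n≢n (sym (cong proj₁ eq))
lowerCell-moves Y (p , zero)  q≢0 _  = q≢0 refl
lowerCell-moves Y (p , suc q) _   eq = ℕP.1+n≢n (sym (cong proj₂ eq))

cellMono : ∀ {N} → Fin N → Cell → Mono N
cellMono {N} r (p , q) = (replicate N 0 [ r ]≔ p , replicate N 0 [ r ]≔ q)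

lookup-cellMono : ∀ {N} ax (r : Fin N) c → lookup (exps ax (cellMono r c)) r ≡ cellExp ax c
lookup-cellMono X r (p , q) = VecP.lookup∘updateAt r (replicate _ 0)
lookup-cellMono Y r (p , q) = VecP.lookup∘updateAt r (replicate _ 0)

lookup-cellMono-≢ : ∀ {N} ax {r s : Fin N} c → s ≢ r → lookup (exps ax (cellMono r c)) s ≡ 0
lookup-cellMono-≢ X {r} {s} (p , q) s≢r = trans (VecP.lookup∘updateAt′ s r s≢r (replicate _ 0)) (VecP.lookup-replicate s 0)
lookup-cellMono-≢ Y {r} {s} (p , q) s≢r = trans (VecP.lookup∘updateAt′ s r s≢r (replicate _ 0)) (VecP.lookup-replicate s 0)

lower-cellMono : ∀ {N} ax (r : Fin N) c → lower ax r (cellMono r c) ≡ cellMono r (lowerCell ax c)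
lower-cellMono X r (p , q) = cong (_, _) (VecP.updateAt-updateAt r (replicate _ 0))
lower-cellMono Y r (p , q) = cong (_ ,_) (VecP.updateAt-updateAt r (replicate _ 0))

∂-monomialRow : ∀ {N} ax (s r : Fin N) c → ∂ ax s (monomialRow r c) ≡ ∂T ax s (1ℚ , cellMono r c) ∷ []
∂-monomialRow ax s r (p , q) = ∂-map ax s (monomialRow r (p , q))

∂Σ-monomialRow : ∀ {N} ax (r : Fin N) c →
  ∂Σ ax (monomialRow r c) ≋ scale (ℕtoℚ (cellExp ax c)) (monomialRow r (lowerCell ax c))
∂Σ-monomialRow ax r c = ≈⇒≋ λ m → begin
  coeff (∂Σ ax (monomialRow r c)) m
    ≡⟨ trans (coeff-∑P (λ s → ∂ ax s (monomialRow r c)) m) (∑-single _ r (off-diagonal m)) ⟩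
  coeff (∂ ax r (monomialRow r c)) m
    ≡⟨ trans (cong (λ p → coeff p m) (∂-monomialRow ax r r c)) (coeff-singleton (∂T ax r (1ℚ , cellMono r c)) m) ⟩
  termCoeff (1ℚ * ℕtoℚ (lookup (exps ax (cellMono r c)) r) , lower ax r (cellMono r c)) m
    ≡⟨ termCoeff-cong m (trans (ℚP.*-identityˡ _) (trans (cong ℕtoℚ (lookup-cellMono ax r c)) (sym (ℚP.*-identityʳ _))))
                        (lower-cellMono ax r c) ⟩
  termCoeff (ℕtoℚ (cellExp ax c) * 1ℚ , cellMono r (lowerCell ax c)) m
    ≡⟨ termCoeff-*ˡ (ℕtoℚ (cellExp ax c)) 1ℚ _ m ⟩
  ℕtoℚ (cellExp ax c) * termCoeff (1ℚ , cellMono r (lowerCell ax c)) m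
    ≡⟨ cong (ℕtoℚ (cellExp ax c) *_) (sym (coeff-singleton (1ℚ , cellMono r (lowerCell ax c)) m)) ⟩
  ℕtoℚ (cellExp ax c) * coeff (monomialRow r (lowerCell ax c)) m
    ≡⟨ sym (coeff-scale (ℕtoℚ (cellExp ax c)) (monomialRow r (lowerCell ax c)) m) ⟩
  coeff (scale (ℕtoℚ (cellExp ax c)) (monomialRow r (lowerCell ax c))) m ∎
  where
  open ≡-Reasoning
  off-diagonal : ∀ m s → s ≢ r → coeff (∂ ax s (monomialRow r c)) m ≡ 0ℚ
  off-diagonal m s s≢r = trans (cong (λ p → coeff p m) (∂-monomialRow ax s r c))
    (trans (coeff-singleton (∂T ax s (1ℚ , cellMono r c)) m)
      (trans (termCoeff-cong m (trans (cong (λ e → 1ℚ * ℕtoℚ e) (lookup-cellMono-≢ ax c s≢r)) (ℚP.*-zeroʳ 1ℚ)) refl)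
             (termCoeff-0 _ m)))

DownClosed : Axis → List Cell → Set
DownClosed ax L = ∀ c → c ∈ L → cellExp ax c ≢ 0 → lowerCell ax c ∈ L

Δ-translationInvariant : ∀ {N} ax (L : Vec Cell N) → DownClosed ax (toList L) → TranslationInvariant ax (Δ L)
Δ-translationInvariant {N} ax L closed = begin
  ∂Σ ax (Δ L)
    ≈⟨ F-cong (Δ≋Det L) ⟩
  ∂Σ ax (scale (normalizer L) (Det (monomialRows N) (toList L)))
    ≈⟨ F-scale (normalizer L) _ ⟩
  scale (normalizer L) (∂Σ ax (Det (monomialRows N) (toList L)))
    ≈⟨ scale-cong (normalizer L) (Det-derivative (∂Σ-isDerivation ax) (cellExp ax) (lowerCell ax)
                                    (monomialRows N) (All-toList-tabulate (∂Σ-monomialRow ax)) (toList L)) ⟩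
  scale (normalizer L) (shiftSum (cellExp ax) (lowerCell ax) (Det (monomialRows N)) (toList L))
    ≈⟨ scale-cong (normalizer L) (shiftSum-closed (cellExp ax) (lowerCell ax) (lowerCell-moves ax)
                                  (Det (monomialRows N)) (Det-alternating (monomialRows N)) [] (toList L) closed) ⟩
  0P ∎
  where
  open ≋-Reasoning
  open IsDerivation (∂Σ-isDerivation {N} ax)

-- Setting the last pair of variables to zero

snoc : ∀ {n} → Mono n → Cell → Mono (suc n)
snoc (a , b) (x , y) = (a ∷ʳ x , b ∷ʳ y)

snoc-init-last : ∀ {n} (m : Mono (suc n)) → m ≡ snoc (init (proj₁ m) , init (proj₂ m)) (last (proj₁ m) , last (proj₂ m))
snoc-init-last (a , b) = cong₂ _,_ (proj₂ (proj₂ (Vec.initLast a))) (proj₂ (proj₂ (Vec.initLast b)))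

restrictT : ∀ {n} → Term (suc n) → Term n
restrictT (c , a , b) = ((if (last a ≡ᵇ 0) ∧ (last b ≡ᵇ 0) then c else 0ℚ) , init a , init b)

restrictT-snoc : ∀ {n} c (m : Mono n) x y → restrictT (c , snoc m (x , y)) ≡ ((if (x ≡ᵇ 0) ∧ (y ≡ᵇ 0) then c else 0ℚ) , m)
restrictT-snoc c (a , b) x y = cong₂ _,_
  (cong₂ (λ u v → if (u ≡ᵇ 0) ∧ (v ≡ᵇ 0) then c else 0ℚ) (VecP.last-∷ʳ x a) (VecP.last-∷ʳ y b))
  (cong₂ _,_ (VecP.init-∷ʳ x a) (VecP.init-∷ʳ y b))

restrictT-coeff : ∀ {n} t (m : Mono n) → termCoeff (restrictT t) m ≡ termCoeff t (snoc m (0 , 0))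
restrictT-coeff (c , a′ , b′) (a , b) with (a′ , b′) ≟M snoc (a , b) (0 , 0)
... | yes refl = trans (cong (λ t → termCoeff t (a , b)) (restrictT-snoc c (a , b) 0 0))
                       (trans (termCoeff-≡ c (a , b)) (sym (termCoeff-≡ c (snoc (a , b) (0 , 0)))))
... | no ≢snoc = trans vanish (sym (termCoeff-≢ c ≢snoc))
  where
  vanish : termCoeff (restrictT (c , a′ , b′)) (a , b) ≡ 0ℚ
  vanish with last a′ in ea | last b′ in eb
  ... | zero  | zero  = termCoeff-≢ c λ e → ≢snoc (trans (snoc-init-last (a′ , b′)) (cong₂ snoc e (cong₂ _,_ ea eb)))
  ... | zero  | suc _ = termCoeff-0 (init a′ , init b′) (a , b)
  ... | suc _ | _     = termCoeff-0 (init a′ , init b′) (a , b)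

coeff-restrict : ∀ {n} (p : Poly (suc n)) m → coeff (restrict p) m ≡ coeff p (snoc m (0 , 0))
coeff-restrict p m = trans (coeff-map restrictT p m)
  (trans (lsum-cong (λ t → restrictT-coeff t m) p) (sym (coeff-lsum p (snoc m (0 , 0)))))

restrict-cong : ∀ {n} {p q : Poly (suc n)} → p ≋ q → restrict p ≋ restrict q
restrict-cong {p = p} {q} e = ≈⇒≋ λ m →
  trans (coeff-restrict p m) (trans (≋⇒≈ e (snoc m (0 , 0))) (sym (coeff-restrict q m)))

restrict-scale : ∀ {n} c (p : Poly (suc n)) → restrict (scale c p) ≋ scale c (restrict p)
restrict-scale c p = ≈⇒≋ λ m → begin
  coeff (restrict (scale c p)) m  ≡⟨ trans (coeff-restrict (scale c p) m) (coeff-scale c p (snoc m (0 , 0))) ⟩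
  c * coeff p (snoc m (0 , 0))    ≡⟨ cong (c *_) (sym (coeff-restrict p m)) ⟩
  c * coeff (restrict p) m        ≡⟨ sym (coeff-scale c (restrict p) m) ⟩
  coeff (scale c (restrict p)) m  ∎
  where open ≡-Reasoning

restrict-isLinear : ∀ {n} → IsLinear (restrict {suc n})
restrict-isLinear = record
  { F-cong = restrict-cong ; F-+P = λ p q → ≡⇒≋ (ListP.map-++ restrictT p q) ; F-scale = restrict-scale }

init-+ᵥ : ∀ {n} (a a′ : Vec ℕ (suc n)) → init (a +ᵥ a′) ≡ init a +ᵥ init a′
init-+ᵥ {zero}  (x ∷ []) (y ∷ []) = refl
init-+ᵥ {suc n} (x ∷ xs) (y ∷ ys) = cong (x ℕ.+ y ∷_) (init-+ᵥ xs ys)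

last-+ᵥ : ∀ {n} (a a′ : Vec ℕ (suc n)) → last (a +ᵥ a′) ≡ last a ℕ.+ last a′
last-+ᵥ {zero}  (x ∷ []) (y ∷ []) = refl
last-+ᵥ {suc n} (x ∷ xs) (y ∷ ys) = last-+ᵥ xs ys

+≡ᵇ0 : ∀ x y → (x ℕ.+ y ≡ᵇ 0) ≡ (x ≡ᵇ 0) ∧ (y ≡ᵇ 0)
+≡ᵇ0 zero    zero    = refl
+≡ᵇ0 zero    (suc y) = refl
+≡ᵇ0 (suc x) y       = refl

if-* : ∀ (g h : Bool) c d → (if g then c else 0ℚ) * (if h then d else 0ℚ) ≡ (if g ∧ h then c * d else 0ℚ)
if-* true  true  c d = refl
if-* true  false c d = ℚP.*-zeroʳ c
if-* false h     c d = ℚP.*-zeroˡ (if h then d else 0ℚ)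

∧-interchange : ∀ a b c d → (a ∧ b) ∧ (c ∧ d) ≡ (a ∧ c) ∧ (b ∧ d)
∧-interchange true  b true  d = refl
∧-interchange true  b false d = BoolP.∧-zeroʳ b
∧-interchange false b c     d = refl

restrictT-·T : ∀ {n} (t t′ : Term (suc n)) → restrictT t ·T restrictT t′ ≡ restrictT (t ·T t′)
restrictT-·T (c , a , b) (d , a′ , b′) = cong₂ _,_
  (trans (if-* (za ∧ zb) (za′ ∧ zb′) c d) (cong (λ z → if z then c * d else 0ℚ)
    (trans (∧-interchange za zb za′ zb′)
           (sym (cong₂ _∧_ (trans (cong (_≡ᵇ 0) (last-+ᵥ a a′)) (+≡ᵇ0 (last a) (last a′)))
                           (trans (cong (_≡ᵇ 0) (last-+ᵥ b b′)) (+≡ᵇ0 (last b) (last b′))))))))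
  (cong₂ _,_ (sym (init-+ᵥ a a′)) (sym (init-+ᵥ b b′)))
  where
  za zb za′ zb′ : Bool
  za = last a ≡ᵇ 0
  zb = last b ≡ᵇ 0
  za′ = last a′ ≡ᵇ 0
  zb′ = last b′ ≡ᵇ 0

restrict-*P : ∀ {n} (p q : Poly (suc n)) → restrict (p *P q) ≋ restrict p *P restrict q
restrict-*P p q = ≈⇒≋ λ m → begin
  coeff (restrict (p *P q)) m
    ≡⟨ trans (coeff-restrict (p *P q) m) (coeff-*P p q (snoc m (0 , 0))) ⟩
  lsum (λ t → lsum (λ t′ → termCoeff (t ·T t′) (snoc m (0 , 0))) q) p
    ≡⟨ lsum-cong (λ t → lsum-cong (λ t′ →
         sym (trans (cong (λ s → termCoeff s m) (restrictT-·T t t′)) (restrictT-coeff (t ·T t′) m))) q) p ⟩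
  lsum (λ t → lsum (λ t′ → termCoeff (restrictT t ·T restrictT t′) m) q) p
    ≡⟨ sym (trans (lsum-map _ restrictT p)
                  (lsum-cong (λ t → lsum-map (λ t′ → termCoeff (restrictT t ·T t′) m) restrictT q) p)) ⟩
  lsum (λ t → lsum (λ t′ → termCoeff (t ·T t′) m) (restrict q)) (restrict p)
    ≡⟨ sym (coeff-*P (restrict p) (restrict q) m) ⟩
  coeff (restrict p *P restrict q) m ∎
  where open ≡-Reasoning

last-replicate : ∀ n → last (replicate (suc n) 0) ≡ 0
last-replicate zero    = refl
last-replicate (suc n) = last-replicate n

init-replicate : ∀ n → init (replicate (suc n) 0) ≡ replicate n 0
init-replicate zero    = refl
init-replicate (suc n) = cong (0 ∷_) (init-replicate n)

restrict-1P : ∀ {n} → restrict {suc n} 1P ≡ 1P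
restrict-1P {n} = cong (_∷ []) (cong₂ _,_
  (cong₂ (λ x y → if (x ≡ᵇ 0) ∧ (y ≡ᵇ 0) then 1ℚ else 0ℚ) (last-replicate n) (last-replicate n))
  (cong₂ _,_ (init-replicate n) (init-replicate n)))

module _ {K : ℕ} where

  Rows≋ : List (Row K) → List (Row K) → Set
  Rows≋ = Pointwise (λ f g → ∀ c → f c ≋ g c)

  Det-cong-rows : ∀ {fs gs} → Rows≋ fs gs → ∀ L → Det fs L ≋ Det gs L
  Det-cong-rows []         []      = ≋-refl
  Det-cong-rows []         (_ ∷ _) = ≋-refl
  Det-cong-rows (e ∷ es) L = expand-cong L e (Det-cong-rows es)

  module _ (e : Row K) (e₀₀ : e (0 , 0) ≋ 1P) (e₀ : ∀ c → c ≢ (0 , 0) → e c ≋ 0P) where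

    Det-unitRow-zero : ∀ fs L → All (_≢ (0 , 0)) L → Det (fs ++ [ e ]) L ≋ 0P
    Det-unitRow-zero []       L ≢00 = expand-zeroˡ-on (Det []) L ≢00 e₀
    Det-unitRow-zero (f ∷ fs) L ≢00 = expand-zeroʳ-on f L ≢00 (Det-unitRow-zero fs)

    Det-unitRow : ∀ fs L → All (_≢ (0 , 0)) L → Det (fs ++ [ e ]) ((0 , 0) ∷ L) ≋ scale (alt (List.length fs)) (Det fs L)
    Det-unitRow [] [] _ = begin
      e (0 , 0) *P 1P +P neg 0P  ≈⟨ +P-cong (≋-trans (*P-congˡ 1P e₀₀) (*P-identityˡ 1P)) ≋-refl ⟩
      1P +P 0P                   ≈⟨ +P-identityʳ 1P ⟩
      1P                         ≈⟨ ≋-sym (scale-1ℚ 1P) ⟩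
      scale 1ℚ 1P                ∎
      where open ≋-Reasoning
    Det-unitRow [] (c ∷ L) _ = +P-cong (*P-zeroʳ (e (0 , 0)) ≋-refl)
      (scale-cong -1q (expand-zeroʳ-on {P = λ _ → ⊤} e (c ∷ L) (All.universal _ (c ∷ L)) (λ _ _ → ≋-refl)))
    Det-unitRow (f ∷ fs) L ≢00 = begin
      f (0 , 0) *P Det (fs ++ [ e ]) L +P neg (expand f (Det (fs ++ [ e ]) ∘ ((0 , 0) ∷_)) L)
        ≈⟨ +P-cong (*P-zeroʳ (f (0 , 0)) (Det-unitRow-zero fs L ≢00))
                   (scale-cong -1q (expand-cong-on L ≢00 (λ _ _ → ≋-refl) (Det-unitRow fs))) ⟩
      0P +P neg (expand f (scale (alt (List.length fs)) ∘ Det fs) L)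
        ≈⟨ scale-cong -1q (expand-scale f (alt (List.length fs)) (Det fs) L) ⟩
      neg (scale (alt (List.length fs)) (Det (f ∷ fs) L))
        ≈⟨ ≋-sym (scale-alt-suc (List.length fs) (Det (f ∷ fs) L)) ⟩
      scale (alt (suc (List.length fs))) (Det (f ∷ fs) L) ∎
      where open ≋-Reasoning

restrict-expand : ∀ {n} (f : Row (suc n)) g L → restrict (expand f g L) ≋ expand (restrict ∘ f) (restrict ∘ g) L
restrict-expand f g []       = ≋-refl
restrict-expand f g (x ∷ xs) = ≋-trans (≡⇒≋ (ListP.map-++ restrictT (f x *P g xs) _))
  (+P-cong (restrict-*P (f x) (g xs))
           (≋-trans (restrict-scale -1q (expand f (g ∘ (x ∷_)) xs)) (scale-cong -1q (restrict-expand f (g ∘ (x ∷_)) xs))))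

restrict-Det : ∀ {n} (fs : List (Row (suc n))) L → restrict (Det fs L) ≋ Det (List.map (restrict ∘_) fs) L
restrict-Det []       []      = ≡⇒≋ restrict-1P
restrict-Det []       (_ ∷ _) = ≋-refl
restrict-Det (f ∷ fs) L = ≋-trans (restrict-expand f (Det fs) L) (expand-cong L (λ _ → ≋-refl) (restrict-Det fs))

-- The last row of the monomial matrix once x_last = y_last = 0.
originRow : ∀ {n} → Row n
originRow {n} (p , q) = ((if (p ≡ᵇ 0) ∧ (q ≡ᵇ 0) then 1ℚ else 0ℚ) , replicate n 0 , replicate n 0) ∷ []

originRow-≢ : ∀ {n} c → c ≢ (0 , 0) → originRow {n} c ≋ 0P
originRow-≢ (zero  , zero)  c≢00 = ⊥-elim (c≢00 refl)
originRow-≢ {n} (zero  , suc q) c≢00 = ≈⇒≋ λ m → trans (coeff-singleton (0ℚ , replicate n 0 , replicate n 0) m) (termCoeff-0 _ m)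
originRow-≢ {n} (suc p , q)     c≢00 = ≈⇒≋ λ m → trans (coeff-singleton (0ℚ , replicate n 0 , replicate n 0) m) (termCoeff-0 _ m)

replicate-∷ʳ : ∀ n (x : ℕ) → replicate (suc n) x ≡ replicate n x ∷ʳ x
replicate-∷ʳ zero    x = refl
replicate-∷ʳ (suc n) x = cong (x ∷_) (replicate-∷ʳ n x)

replicate-≔-inject₁ : ∀ n (r : Fin n) p → replicate (suc n) 0 [ inject₁ r ]≔ p ≡ (replicate n 0 [ r ]≔ p) ∷ʳ 0
replicate-≔-inject₁ (suc n) zero    p = cong (p ∷_) (replicate-∷ʳ n 0)
replicate-≔-inject₁ (suc n) (suc r) p = cong (0 ∷_) (replicate-≔-inject₁ n r p)

replicate-≔-fromℕ : ∀ n p → replicate (suc n) 0 [ fromℕ n ]≔ p ≡ replicate n 0 ∷ʳ p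
replicate-≔-fromℕ zero    p = refl
replicate-≔-fromℕ (suc n) p = cong (0 ∷_) (replicate-≔-fromℕ n p)

restrict-monomialRow-inject₁ : ∀ {n} (r : Fin n) c → restrict (monomialRow (inject₁ r) c) ≡ monomialRow r c
restrict-monomialRow-inject₁ {n} r (p , q) = cong (_∷ [])
  (trans (cong₂ (λ A B → restrictT (1ℚ , A , B)) (replicate-≔-inject₁ n r p) (replicate-≔-inject₁ n r q))
         (restrictT-snoc 1ℚ (cellMono r (p , q)) 0 0))

restrict-monomialRow-fromℕ : ∀ {n} c → restrict (monomialRow (fromℕ n) c) ≡ originRow c
restrict-monomialRow-fromℕ {n} (p , q) = cong (_∷ [])
  (trans (cong₂ (λ A B → restrictT (1ℚ , A , B)) (replicate-≔-fromℕ n p) (replicate-≔-fromℕ n q))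
         (restrictT-snoc 1ℚ (replicate n 0 , replicate n 0) p q))

tabulate-∷ʳ : ∀ {n} {A : Set} (h : Fin (suc n) → A) → tabulate h ≡ tabulate (h ∘ inject₁) ∷ʳ h (fromℕ n)
tabulate-∷ʳ {zero}  h = refl
tabulate-∷ʳ {suc n} h = cong (h zero ∷_) (tabulate-∷ʳ (h ∘ suc))

restrict-tabulate : ∀ {n m} (h : Fin m → Row (suc n)) (h′ : Fin m → Row n) → (∀ i c → restrict (h i c) ≡ h′ i c) →
  Rows≋ (List.map (restrict ∘_) (toList (tabulate h))) (toList (tabulate h′))
restrict-tabulate {m = zero}  h h′ e = []
restrict-tabulate {m = suc m} h h′ e = (λ c → ≡⇒≋ (e zero c)) ∷ restrict-tabulate (h ∘ suc) (h′ ∘ suc) (e ∘ suc)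

restrict-monomialRows : ∀ n → Rows≋ (List.map (restrict ∘_) (monomialRows (suc n))) (monomialRows n ++ [ originRow ])
restrict-monomialRows n = subst (λ fs → Rows≋ (List.map (restrict ∘_) fs) (monomialRows n ++ [ originRow ])) (sym split)
  (subst (λ gs → Rows≋ gs (monomialRows n ++ [ originRow ])) (sym (ListP.map-++ (restrict ∘_) inits [ monomialRow (fromℕ n) ]))
    (Pointwise.++⁺ (restrict-tabulate (monomialRow ∘ inject₁) monomialRow restrict-monomialRow-inject₁)
                   ((λ c → ≡⇒≋ (restrict-monomialRow-fromℕ c)) ∷ [])))
  where
  inits : List (Row (suc n))
  inits = toList (tabulate (monomialRow ∘ inject₁))
  split : monomialRows (suc n) ≡ inits ++ [ monomialRow (fromℕ n) ]
  split = trans (cong toList (tabulate-∷ʳ monomialRow)) (VecP.toList-∷ʳ (monomialRow (fromℕ n)) (tabulate (monomialRow ∘ inject₁)))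

-- After the substitution the last row of the matrix is (1, 0, …, 0).
restrict-Δ : ∀ {n} (L : Vec Cell n) → All (_≢ (0 , 0)) (toList L) → restrict (Δ ((0 , 0) ∷ L)) ≋ scale (alt n) (Δ L)
restrict-Δ {n} L ≢00 = begin
  restrict (Δ ((0 , 0) ∷ L))
    ≈⟨ ≋-trans (restrict-cong (Δ≋Det ((0 , 0) ∷ L))) (restrict-scale ν _) ⟩
  scale ν (restrict (Det (monomialRows (suc n)) ((0 , 0) ∷ toList L)))
    ≈⟨ scale-cong ν (≋-trans (restrict-Det (monomialRows (suc n)) _) (Det-cong-rows (restrict-monomialRows n) _)) ⟩
  scale ν (Det (monomialRows n ++ [ originRow ]) ((0 , 0) ∷ toList L))
    ≈⟨ scale-cong ν (Det-unitRow originRow ≋-refl originRow-≢ (monomialRows n) (toList L) ≢00) ⟩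
  scale ν (scale (alt (List.length (monomialRows n))) (Det (monomialRows n) (toList L)))
    ≈⟨ ≡⇒≋ (cong (λ l → scale ν (scale (alt l) (Det (monomialRows n) (toList L))))
                 (VecP.length-toList (tabulate (monomialRow {n})))) ⟩
  scale ν (scale (alt n) (Det (monomialRows n) (toList L)))
    ≈⟨ scale-comm ν (alt n) (Det (monomialRows n) (toList L)) ⟩
  scale (alt n) (scale ν (Det (monomialRows n) (toList L)))
    ≈⟨ ≡⇒≋ (cong (λ c → scale (alt n) (scale c (Det (monomialRows n) (toList L)))) (ℚP.*-identityˡ (normalizer L))) ⟩
  scale (alt n) (scale (normalizer L) (Det (monomialRows n) (toList L)))
    ≈⟨ scale-cong (alt n) (≋-sym (Δ≋Det L)) ⟩
  scale (alt n) (Δ L) ∎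
  where
  open ≋-Reasoning
  ν : ℚ
  ν = normalizer ((0 , 0) ∷ L)

lookup-∷ʳ-inject₁ : ∀ {n} (a : Vec ℕ n) x (i : Fin n) → lookup (a ∷ʳ x) (inject₁ i) ≡ lookup a i
lookup-∷ʳ-inject₁ (y ∷ a) x zero    = refl
lookup-∷ʳ-inject₁ (y ∷ a) x (suc i) = lookup-∷ʳ-inject₁ a x i

updateAt-∷ʳ-inject₁ : ∀ {n} (a : Vec ℕ n) x (i : Fin n) f → updateAt (a ∷ʳ x) (inject₁ i) f ≡ updateAt a i f ∷ʳ x
updateAt-∷ʳ-inject₁ (y ∷ a) x zero    f = refl
updateAt-∷ʳ-inject₁ (y ∷ a) x (suc i) f = cong (y ∷_) (updateAt-∷ʳ-inject₁ a x i f)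

lookup-∷ʳ-fromℕ : ∀ {n} (a : Vec ℕ n) x → lookup (a ∷ʳ x) (fromℕ n) ≡ x
lookup-∷ʳ-fromℕ []      x = refl
lookup-∷ʳ-fromℕ (y ∷ a) x = lookup-∷ʳ-fromℕ a x

updateAt-∷ʳ-fromℕ : ∀ {n} (a : Vec ℕ n) x f → updateAt (a ∷ʳ x) (fromℕ n) f ≡ a ∷ʳ f x
updateAt-∷ʳ-fromℕ []      x f = refl
updateAt-∷ʳ-fromℕ (y ∷ a) x f = cong (y ∷_) (updateAt-∷ʳ-fromℕ a x f)

raiseCell : Axis → Cell → Cell
raiseCell X (p , q) = (suc p , q)
raiseCell Y (p , q) = (p , suc q)

lookup-snoc-inject₁ : ∀ {n} ax (m : Mono n) c i → lookup (exps ax (snoc m c)) (inject₁ i) ≡ lookup (exps ax m) i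
lookup-snoc-inject₁ X (a , b) (x , y) i = lookup-∷ʳ-inject₁ a x i
lookup-snoc-inject₁ Y (a , b) (x , y) i = lookup-∷ʳ-inject₁ b y i

raise-snoc-inject₁ : ∀ {n} ax (m : Mono n) c i → raise ax (inject₁ i) (snoc m c) ≡ snoc (raise ax i m) c
raise-snoc-inject₁ X (a , b) (x , y) i = cong (_, b ∷ʳ y) (updateAt-∷ʳ-inject₁ a x i suc)
raise-snoc-inject₁ Y (a , b) (x , y) i = cong (a ∷ʳ x ,_) (updateAt-∷ʳ-inject₁ b y i suc)

lookup-snoc-fromℕ : ∀ {n} ax (m : Mono n) c → lookup (exps ax (snoc m c)) (fromℕ n) ≡ cellExp ax c
lookup-snoc-fromℕ X (a , b) (x , y) = lookup-∷ʳ-fromℕ a x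
lookup-snoc-fromℕ Y (a , b) (x , y) = lookup-∷ʳ-fromℕ b y

raise-snoc-fromℕ : ∀ {n} ax (m : Mono n) c → raise ax (fromℕ n) (snoc m c) ≡ snoc m (raiseCell ax c)
raise-snoc-fromℕ X (a , b) (x , y) = cong (_, b ∷ʳ y) (updateAt-∷ʳ-fromℕ a x suc)
raise-snoc-fromℕ Y (a , b) (x , y) = cong (a ∷ʳ x ,_) (updateAt-∷ʳ-fromℕ b y suc)

coeff-∂-inject₁-snoc : ∀ {n} ax (i : Fin n) p m c →
  coeff (∂ ax (inject₁ i) p) (snoc m c) ≡ ∂-weight ax i m * coeff p (snoc (raise ax i m) c)
coeff-∂-inject₁-snoc ax i p m c = trans (coeff-∂ ax (inject₁ i) p (snoc m c))
  (cong₂ (λ e m′ → ℕtoℚ (suc e) * coeff p m′) (lookup-snoc-inject₁ ax m c i) (raise-snoc-inject₁ ax m c i))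

coeff-∂-fromℕ-snoc : ∀ {n} ax p (m : Mono n) c →
  coeff (∂ ax (fromℕ n) p) (snoc m c) ≡ ℕtoℚ (suc (cellExp ax c)) * coeff p (snoc m (raiseCell ax c))
coeff-∂-fromℕ-snoc ax p m c = trans (coeff-∂ ax (fromℕ _) p (snoc m c))
  (cong₂ (λ e m′ → ℕtoℚ (suc e) * coeff p m′) (lookup-snoc-fromℕ ax m c) (raise-snoc-fromℕ ax m c))

invariant-∂-fromℕ : ∀ {n} ax {p} → TranslationInvariant ax p → ∀ m →
  coeff (∂ ax (fromℕ n) p) m ≡ ℚ.- ∑ (λ i → coeff (∂ ax (inject₁ i) p) m)
invariant-∂-fromℕ ax {p} inv m = begin
  ∂last                   ≡⟨ solve 2 (λ l s → l := (s :+ l) :+ :- s) refl ∂last S ⟩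
  (S + ∂last) + ℚ.- S   ≡⟨ cong (_+ ℚ.- S) (trans (sym (trans (coeff-∑P (λ i → ∂ ax i p) m)
                                                                  (sum-init-last (λ i → coeff (∂ ax i p) m))))
                                                (≋⇒≈ inv m)) ⟩
  0ℚ + ℚ.- S  ≡⟨ ℚP.+-identityˡ (ℚ.- S) ⟩
  ℚ.- S       ∎
  where
  open ≡-Reasoning
  ∂last S : ℚ
  ∂last = coeff (∂ ax (fromℕ _) p) m
  S = ∑ (λ i → coeff (∂ ax (inject₁ i) p) m)

restrict-∂-inject₁ : ∀ {n} ax (i : Fin n) p → restrict (∂ ax (inject₁ i) p) ≋ ∂ ax i (restrict p)
restrict-∂-inject₁ ax i p = ≈⇒≋ λ m → begin
  coeff (restrict (∂ ax (inject₁ i) p)) m                  ≡⟨ coeff-restrict (∂ ax (inject₁ i) p) m ⟩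
  coeff (∂ ax (inject₁ i) p) (snoc m (0 , 0))              ≡⟨ coeff-∂-inject₁-snoc ax i p m (0 , 0) ⟩
  ∂-weight ax i m * coeff p (snoc (raise ax i m) (0 , 0))  ≡⟨ cong (∂-weight ax i m *_) (sym (coeff-restrict p (raise ax i m))) ⟩
  ∂-weight ax i m * coeff (restrict p) (raise ax i m)      ≡⟨ sym (coeff-∂ ax i (restrict p) m) ⟩
  coeff (∂ ax i (restrict p)) m                            ∎
  where open ≡-Reasoning

restrict-∂-fromℕ : ∀ {n} ax p → TranslationInvariant ax p → restrict (∂ ax (fromℕ n) p) ≋ neg (∂Σ ax (restrict p))
restrict-∂-fromℕ ax p inv = ≈⇒≋ λ m → begin
  coeff (restrict (∂ ax (fromℕ _) p)) m                           ≡⟨ coeff-restrict (∂ ax (fromℕ _) p) m ⟩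
  coeff (∂ ax (fromℕ _) p) (snoc m (0 , 0))                       ≡⟨ invariant-∂-fromℕ ax inv (snoc m (0 , 0)) ⟩
  ℚ.- ∑ (λ i → coeff (∂ ax (inject₁ i) p) (snoc m (0 , 0)))      ≡⟨ cong ℚ.-_ (sum-cong-≗ λ i →
                                                                      trans (sym (coeff-restrict (∂ ax (inject₁ i) p) m))
                                                                            (≋⇒≈ (restrict-∂-inject₁ ax i p) m)) ⟩
  ℚ.- ∑ (λ i → coeff (∂ ax i (restrict p)) m)  ≡⟨ cong ℚ.-_ (sym (coeff-∑P (λ i → ∂ ax i (restrict p)) m)) ⟩
  ℚ.- coeff (∂Σ ax (restrict p)) m             ≡⟨ sym (coeff-neg (∂Σ ax (restrict p)) m) ⟩
  coeff (neg (∂Σ ax (restrict p))) m           ∎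
  where open ≡-Reasoning

-- In the coefficient of snoc m c in ∂Σ p = 0 only the last-variable term
-- involves the exponents raiseCell c.
invariant-vanishes-raiseCell : ∀ {n} ax {p : Poly (suc n)} → TranslationInvariant ax p → ∀ c →
  (∀ m → coeff p (snoc m c) ≡ 0ℚ) → ∀ m → coeff p (snoc m (raiseCell ax c)) ≡ 0ℚ
invariant-vanishes-raiseCell ax {p} inv c vanish m = ℕtoℚ-suc-cancel (cellExp ax c) (begin
  ℕtoℚ (suc (cellExp ax c)) * coeff p (snoc m (raiseCell ax c))
    ≡⟨ sym (coeff-∂-fromℕ-snoc ax p m c) ⟩
  coeff (∂ ax (fromℕ _) p) (snoc m c)
    ≡⟨ invariant-∂-fromℕ ax inv (snoc m c) ⟩
  ℚ.- ∑ (λ i → coeff (∂ ax (inject₁ i) p) (snoc m c))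
    ≡⟨ cong ℚ.-_ (∑-0 _ λ i → trans (coeff-∂-inject₁-snoc ax i p m c)
                                    (trans (cong (∂-weight ax i m *_) (vanish (raise ax i m))) (ℚP.*-zeroʳ (∂-weight ax i m)))) ⟩
  ℚ.- 0ℚ ≡⟨⟩
  0ℚ ∎)
  where open ≡-Reasoning

restrict-injective : ∀ {n} {p : Poly (suc n)} → TranslationInvariant X p → TranslationInvariant Y p →
  restrict p ≋ 0P → p ≋ 0P
restrict-injective {p = p} invX invY restrict≋0 = ≈⇒≋ λ m →
  trans (cong (coeff p) (snoc-init-last m)) (along-Y (last (proj₂ m)) (last (proj₁ m)) _)
  where
  along-X : ∀ x m → coeff p (snoc m (x , 0)) ≡ 0ℚ
  along-X zero    m = trans (sym (coeff-restrict p m)) (≋⇒≈ restrict≋0 m)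
  along-X (suc x) = invariant-vanishes-raiseCell X invX (x , 0) (along-X x)
  along-Y : ∀ y x m → coeff p (snoc m (x , y)) ≡ 0ℚ
  along-Y zero    x = along-X x
  along-Y (suc y) x = invariant-vanishes-raiseCell Y invY (x , y) (along-Y y x)

module _ {k : ℕ} where

  -- InM D is Span (IsDeriv D) definitionally.
  Span : (Poly k → Set) → Poly k → Set
  Span S p = Σ ℕ λ m → Σ (Vec (Poly k) m) λ ds → Σ (Vec ℚ m) λ cs → VecAll.All S ds × (p ≈ lincomb cs ds)

  InSpanOf : ∀ {m} → Vec (Poly k) m → Poly k → Set
  InSpanOf {m} B p = Σ (Vec ℚ m) λ cs → p ≈ lincomb cs B

  lincomb-++ : ∀ {m m′} (cs : Vec ℚ m) (ds : Vec (Poly k) m) (cs′ : Vec ℚ m′) (ds′ : Vec (Poly k) m′) →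
    lincomb (cs Vec.++ cs′) (ds Vec.++ ds′) ≋ lincomb cs ds +P lincomb cs′ ds′
  lincomb-++ []       []       cs′ ds′ = ≋-refl
  lincomb-++ (c ∷ cs) (d ∷ ds) cs′ ds′ = ≋-trans (+P-cong (≋-refl {p = scale c d}) (lincomb-++ cs ds cs′ ds′))
    (≋-sym (+P-assoc (scale c d) (lincomb cs ds) (lincomb cs′ ds′)))

  lincomb-scale : ∀ {m} c (cs : Vec ℚ m) (ds : Vec (Poly k) m) → lincomb (Vec.map (c *_) cs) ds ≋ scale c (lincomb cs ds)
  lincomb-scale c []        []       = ≋-refl
  lincomb-scale c (c′ ∷ cs) (d ∷ ds) = ≋-trans (+P-cong (≋-sym (scale-scale c c′ d)) (lincomb-scale c cs ds))
    (≋-sym (scale-+P c (scale c′ d) (lincomb cs ds)))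

  lincomb-0 : ∀ {m} (B : Vec (Poly k) m) → lincomb (replicate m 0ℚ) B ≋ 0P
  lincomb-0 []      = ≋-refl
  lincomb-0 (b ∷ B) = +P-cong (scale-0ℚ b) (lincomb-0 B)

  lincomb-+ : ∀ {m} (cs cs′ : Vec ℚ m) (B : Vec (Poly k) m) → lincomb (Vec.zipWith _+_ cs cs′) B ≋ lincomb cs B +P lincomb cs′ B
  lincomb-+ []       []         []      = ≋-refl
  lincomb-+ (c ∷ cs) (c′ ∷ cs′) (b ∷ B) = begin
    scale (c + c′) b +P lincomb (Vec.zipWith _+_ cs cs′) B
      ≈⟨ +P-cong (scale-distribʳ c c′ b) (lincomb-+ cs cs′ B) ⟩
    (scale c b +P scale c′ b) +P (lincomb cs B +P lincomb cs′ B)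
      ≈⟨ +P-solve 4 (λ a b c d → (a ⊕ b) ⊕ (c ⊕ d) ⊜ (a ⊕ c) ⊕ (b ⊕ d)) ≋-refl
                    (scale c b) (scale c′ b) (lincomb cs B) (lincomb cs′ B) ⟩
    lincomb (c ∷ cs) (b ∷ B) +P lincomb (c′ ∷ cs′) (b ∷ B) ∎
    where
    open ≋-Reasoning
    open +P-Solver using (_⊕_; _⊜_) renaming (solve to +P-solve)

  module _ {S : Poly k → Set} where

    span-≋ : ∀ {p q} → Span S p → p ≋ q → Span S q
    span-≋ (m , ds , cs , S-ds , p≈) p≋q = m , ds , cs , S-ds , λ x → trans (sym (≋⇒≈ p≋q x)) (p≈ x)

    span-gen : ∀ {p} → S p → Span S p
    span-gen {p} Sp = 1 , p ∷ [] , 1ℚ ∷ [] , Sp ∷ [] , ≋⇒≈ (≋-sym (≋-trans (+P-identityʳ (scale 1ℚ p)) (scale-1ℚ p)))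

    span-0P : Span S 0P
    span-0P = 0 , [] , [] , [] , λ m → refl

    span-+P : ∀ {p q} → Span S p → Span S q → Span S (p +P q)
    span-+P {p} {q} (m , ds , cs , S-ds , p≈) (m′ , ds′ , cs′ , S-ds′ , q≈) =
      m ℕ.+ m′ , ds Vec.++ ds′ , cs Vec.++ cs′ , VecAllP.++⁺ S-ds S-ds′ ,
      ≋⇒≈ (≋-trans (+P-cong (≈⇒≋ {p = p} {lincomb cs ds} p≈) (≈⇒≋ {p = q} {lincomb cs′ ds′} q≈))
                   (≋-sym (lincomb-++ cs ds cs′ ds′)))

    span-scale : ∀ c {p} → Span S p → Span S (scale c p)
    span-scale c {p} (m , ds , cs , S-ds , p≈) =
      m , ds , Vec.map (c *_) cs , S-ds ,
      ≋⇒≈ (≋-trans (scale-cong c (≈⇒≋ {p = p} {lincomb cs ds} p≈)) (≋-sym (lincomb-scale c cs ds)))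

    span-∑P : ∀ {n} (h : Fin n → Poly k) → (∀ i → Span S (h i)) → Span S (∑P h)
    span-∑P {zero}  h Sh = span-0P
    span-∑P {suc n} h Sh = span-+P {h zero} {∑P (h ∘ suc)} (Sh zero) (span-∑P (h ∘ suc) (Sh ∘ suc))

    span-lincomb : ∀ {m} (cs : Vec ℚ m) (ds : Vec (Poly k) m) → VecAll.All (Span S) ds → Span S (lincomb cs ds)
    span-lincomb []       []       []           = span-0P
    span-lincomb (c ∷ cs) (d ∷ ds) (Sd ∷ S-ds) = span-+P {scale c d} {lincomb cs ds} (span-scale c {d} Sd) (span-lincomb cs ds S-ds)

    span⇒inSpanOf : ∀ {m} (B : Vec (Poly k) m) → (∀ q → S q → InSpanOf B q) → ∀ {p} → Span S p → InSpanOf B p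
    span⇒inSpanOf {m} B gens (_ , ds , cs , S-ds , p≈) = let cs′ , e = combine cs ds S-ds in cs′ , λ x → trans (p≈ x) (e x)
      where
      combine : ∀ {m′} (cs : Vec ℚ m′) (ds : Vec (Poly k) m′) → VecAll.All S ds → InSpanOf B (lincomb cs ds)
      combine []       []       []           = replicate m 0ℚ , ≋⇒≈ (≋-sym (lincomb-0 B))
      combine (c ∷ cs) (d ∷ ds) (Sd ∷ S-ds) with gens d Sd | combine cs ds S-ds
      ... | a , d≈ | a′ , rest≈ = Vec.zipWith _+_ (Vec.map (c *_) a) a′ ,
        ≋⇒≈ (≋-trans (+P-cong (scale-cong c (≈⇒≋ {p = d} {lincomb a B} d≈))
                              (≈⇒≋ {p = lincomb cs ds} {lincomb a′ B} rest≈))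
               (≋-trans (+P-cong (≋-sym (lincomb-scale c a B)) ≋-refl) (≋-sym (lincomb-+ (Vec.map (c *_) a) a′ B))))

module _ {k j : ℕ} {F : Poly k → Poly j} (F-linear : IsLinear F) where
  open IsLinear F-linear

  linear-span : ∀ {S T} → (∀ q → S q → Span T (F q)) → ∀ {p} → Span S p → Span T (F p)
  linear-span S⇒T {p} (m , ds , cs , S-ds , p≈) =
    span-≋ (span-lincomb cs (Vec.map F ds) (images ds S-ds))
           (≋-sym (≋-trans (F-cong (≈⇒≋ {p = p} {lincomb cs ds} p≈)) (F-lincomb cs ds)))
    where
    images : ∀ {m} (ds : Vec (Poly k) m) → VecAll.All _ ds → VecAll.All _ (Vec.map F ds)
    images []       []           = []
    images (d ∷ ds) (Sd ∷ S-ds) = S⇒T d Sd ∷ images ds S-ds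

  linear-kills-span : ∀ {S} → (∀ q → S q → F q ≋ 0P) → ∀ {p} → Span S p → F p ≋ 0P
  linear-kills-span S⇒0 {p} (m , ds , cs , S-ds , p≈) =
    ≋-trans (F-cong (≈⇒≋ {p = p} {lincomb cs ds} p≈)) (≋-trans (F-lincomb cs ds) (kill cs ds S-ds))
    where
    kill : ∀ {m} (cs : Vec ℚ m) (ds : Vec (Poly k) m) → VecAll.All _ ds → lincomb cs (Vec.map F ds) ≋ 0P
    kill []       []       []           = ≋-refl
    kill (c ∷ cs) (d ∷ ds) (Sd ∷ S-ds) = +P-cong (scale-cong c (S⇒0 d Sd)) (kill cs ds S-ds)

-- Restricting a basis of M_{(0,0) ∷ L}

module _ {n : ℕ} (L : Vec Cell n) (L≢00 : All (_≢ (0 , 0)) (toList L))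
         (closed : ∀ ax → DownClosed ax (toList ((0 , 0) ∷ L))) where

  Δ₀ : Poly (suc n)
  Δ₀ = Δ ((0 , 0) ∷ L)

  derivative-invariant : ∀ {q} → IsDeriv Δ₀ q → ∀ ax → TranslationInvariant ax q
  derivative-invariant here     ax = Δ-translationInvariant ax ((0 , 0) ∷ L) (closed ax)
  derivative-invariant (dx i d) ax = ∂-translationInvariant ax X i (derivative-invariant d ax)
  derivative-invariant (dy i d) ax = ∂-translationInvariant ax Y i (derivative-invariant d ax)

  span-invariant : ∀ {p} → Span (IsDeriv Δ₀) p → ∀ ax → TranslationInvariant ax p
  span-invariant s ax = linear-kills-span (IsDerivation.isLinear (∂Σ-isDerivation ax)) (λ q d → derivative-invariant d ax) s

  span-∂ : ∀ ax j {p} → Span (IsDeriv (Δ L)) p → Span (IsDeriv (Δ L)) (∂ ax j p)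
  span-∂ ax j = linear-span (∂-isLinear ax j) (λ q d → span-gen (IsDeriv-∂ ax j d))

  Δ≋scale-restrict-Δ₀ : Δ L ≋ scale (alt n) (restrict Δ₀)
  Δ≋scale-restrict-Δ₀ = ≋-sym (begin
    scale (alt n) (restrict Δ₀)          ≈⟨ scale-cong (alt n) (restrict-Δ L L≢00) ⟩
    scale (alt n) (scale (alt n) (Δ L))  ≈⟨ scale-scale (alt n) (alt n) (Δ L) ⟩
    scale (alt n * alt n) (Δ L)          ≈⟨ ≡⇒≋ (cong (λ c → scale c (Δ L)) (alt-involutive n)) ⟩
    scale 1ℚ (Δ L)                       ≈⟨ scale-1ℚ (Δ L) ⟩
    Δ L                                  ∎)
    where open ≋-Reasoning

  restrict-derivative : ∀ {q} → IsDeriv Δ₀ q → Span (IsDeriv (Δ L)) (restrict q)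
  restrict-∂-derivative : ∀ ax i {q} → IsDeriv Δ₀ q → Span (IsDeriv (Δ L)) (restrict (∂ ax i q))

  restrict-derivative here     = span-≋ (span-scale (alt n) {Δ L} (span-gen here)) (≋-sym (restrict-Δ L L≢00))
  restrict-derivative (dx i d) = restrict-∂-derivative X i d
  restrict-derivative (dy i d) = restrict-∂-derivative Y i d

  restrict-∂-derivative ax i {q} d with Top.view i
  ... | ‵fromℕ     = span-≋ (span-scale -1q {∂Σ ax (restrict q)}
                                         (span-∑P (λ j → ∂ ax j (restrict q)) (λ j → span-∂ ax j (restrict-derivative d))))
                            (≋-sym (restrict-∂-fromℕ ax q (derivative-invariant d ax)))
  ... | ‵inject₁ j = span-≋ (span-∂ ax j (restrict-derivative d)) (≋-sym (restrict-∂-inject₁ ax j q))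

  lift-derivative : ∀ {q′} → IsDeriv (Δ L) q′ → Σ (Poly (suc n)) λ q → IsDeriv Δ₀ q × q′ ≋ scale (alt n) (restrict q)
  lift-∂-derivative : ∀ ax j {q′} → IsDeriv (Δ L) q′ →
    Σ (Poly (suc n)) λ q → IsDeriv Δ₀ q × ∂ ax j q′ ≋ scale (alt n) (restrict q)

  lift-derivative here     = Δ₀ , here , Δ≋scale-restrict-Δ₀
  lift-derivative (dx j d) = lift-∂-derivative X j d
  lift-derivative (dy j d) = lift-∂-derivative Y j d

  lift-∂-derivative ax j {q′} d with lift-derivative d
  ... | q , dq , q′≋ = ∂ ax (inject₁ j) q , IsDeriv-∂ ax (inject₁ j) dq , (begin
    ∂ ax j q′                                   ≈⟨ ∂-cong ax j q′≋ ⟩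
    ∂ ax j (scale (alt n) (restrict q))         ≈⟨ ∂-scale ax j (alt n) (restrict q) ⟩
    scale (alt n) (∂ ax j (restrict q))         ≈⟨ scale-cong (alt n) (≋-sym (restrict-∂-inject₁ ax j q)) ⟩
    scale (alt n) (restrict (∂ ax (inject₁ j) q)) ∎)
    where open ≋-Reasoning

  restrict-basis : ∀ {m} (B : Vec (Poly (suc n)) m) → IsBasis (InML ((0 , 0) ∷ L)) B → IsBasis (InML L) (Vec.map restrict B)
  restrict-basis B basis = record { members = members ; indep = indep ; spans = spans }
    where
    open IsBasis basis renaming (members to B-members; indep to B-indep; spans to B-spans)
    open IsLinear (restrict-isLinear {n})

    members : VecAll.All (InML L) (Vec.map restrict B)
    members = VecAllP.map⁺ (VecAll.map {Q = InML L ∘ restrict}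
      (λ {b} → linear-span restrict-isLinear {S = IsDeriv Δ₀} {T = IsDeriv (Δ L)} (λ q → restrict-derivative) {b}) B-members)

    indep : LinIndep (Vec.map restrict B)
    indep cs restrict≈0 = B-indep cs (≋⇒≈ (restrict-injective (invariant X) (invariant Y) restrict≋0))
      where
      invariant : ∀ ax → TranslationInvariant ax (lincomb cs B)
      invariant = span-invariant (span-lincomb cs B B-members)
      restrict≋0 : restrict (lincomb cs B) ≋ 0P
      restrict≋0 = ≋-trans (F-lincomb cs B) (≈⇒≋ restrict≈0)

    spans : Spans (InML L) (Vec.map restrict B)
    spans p = span⇒inSpanOf {S = IsDeriv (Δ L)} (Vec.map restrict B) generators {p}
      where
      generators : ∀ q′ → IsDeriv (Δ L) q′ → InSpanOf (Vec.map restrict B) q′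
      generators q′ d with lift-derivative d
      ... | q , dq , q′≋ with B-spans q (span-gen dq)
      ...   | cs , q≈ = Vec.map (alt n *_) cs , ≋⇒≈ (begin
        q′                                               ≈⟨ q′≋ ⟩
        scale (alt n) (restrict q)                       ≈⟨ scale-cong (alt n) (restrict-cong (≈⇒≋ {p = q} {lincomb cs B} q≈)) ⟩
        scale (alt n) (restrict (lincomb cs B))          ≈⟨ scale-cong (alt n) (F-lincomb cs B) ⟩
        scale (alt n) (lincomb cs (Vec.map restrict B))  ≈⟨ ≋-sym (lincomb-scale (alt n) cs (Vec.map restrict B)) ⟩
        lincomb (Vec.map (alt n *_) cs) (Vec.map restrict B) ∎)
        where open ≋-Reasoning

-- Ferrers diagrams

rowLength : List ℕ → ℕ → ℕ
rowLength []      _       = 0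
rowLength (a ∷ μ) zero    = a
rowLength (a ∷ μ) (suc i) = rowLength μ i

∈-toList-tabulate⁻ : ∀ {a} {A : Set} (g : Fin a → A) {c} → c ∈ toList (tabulate g) → Σ (Fin a) λ j → c ≡ g j
∈-toList-tabulate⁻ {suc a} g (here e)  = zero , e
∈-toList-tabulate⁻ {suc a} g (there c∈) = let j , e = ∈-toList-tabulate⁻ (g ∘ suc) c∈ in suc j , e

∈-toList-tabulate⁺ : ∀ {a} {A : Set} (g : Fin a → A) j → g j ∈ toList (tabulate g)
∈-toList-tabulate⁺ g zero    = here refl
∈-toList-tabulate⁺ g (suc j) = there (∈-toList-tabulate⁺ (g ∘ suc) j)

∈-row⁻ : ∀ i a {c} → c ∈ toList (row i a) → proj₁ c ≡ i × proj₂ c < a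
∈-row⁻ i a c∈ with ∈-toList-tabulate⁻ (λ j → i , toℕ j) c∈
... | j , refl = refl , FinP.toℕ<n j

∈-row⁺ : ∀ i a {j} → j < a → (i , j) ∈ toList (row i a)
∈-row⁺ i a j<a = subst (λ z → (i , z) ∈ toList (row i a)) (FinP.toℕ-fromℕ< j<a)
  (∈-toList-tabulate⁺ (λ j → i , toℕ j) (Fin.fromℕ< j<a))

∸-suc : ∀ k i → suc k ≤ i → i ∸ k ≡ suc (i ∸ suc k)
∸-suc zero    (suc i) _          = refl
∸-suc (suc k) (suc i) (s≤s k<i) = ∸-suc k i k<i

∈-cellsFrom⁻ : ∀ k μ {c} → c ∈ toList (cellsFrom k μ) → k ≤ proj₁ c × proj₂ c < rowLength μ (proj₁ c ∸ k)
∈-cellsFrom⁻ k (a ∷ μ) {c} c∈ with ∈-++⁻ (toList (row k a)) (subst (c ∈_) (VecP.toList-++ (row k a) (cellsFrom (suc k) μ)) c∈)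
... | inj₁ c∈row with ∈-row⁻ k a c∈row
...   | refl , j<a = ℕP.≤-refl , subst (λ z → proj₂ c < rowLength (a ∷ μ) z) (sym (ℕP.n∸n≡0 k)) j<a
∈-cellsFrom⁻ k (a ∷ μ) {c} c∈ | inj₂ c∈rest with ∈-cellsFrom⁻ (suc k) μ c∈rest
... | k<i , j< = ℕP.≤-trans (ℕP.n≤1+n k) k<i , subst (λ z → proj₂ c < rowLength (a ∷ μ) z) (sym (∸-suc k (proj₁ c) k<i)) j<

∈-cellsFrom⁺ : ∀ k μ {i j} → k ≤ i → j < rowLength μ (i ∸ k) → (i , j) ∈ toList (cellsFrom k μ)
∈-cellsFrom⁺ k (a ∷ μ) {i} {j} k≤i j< = subst ((i , j) ∈_) (sym (VecP.toList-++ (row k a) (cellsFrom (suc k) μ))) ∈++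
  where
  ∈++ : (i , j) ∈ toList (row k a) ++ toList (cellsFrom (suc k) μ)
  ∈++ with i ℕ.≟ k
  ... | yes refl = ∈-++⁺ˡ (∈-row⁺ i a (subst (λ z → j < rowLength (a ∷ μ) z) (ℕP.n∸n≡0 i) j<))
  ... | no i≢k   = ∈-++⁺ʳ (toList (row k a))
    (∈-cellsFrom⁺ (suc k) μ k<i (subst (λ z → j < rowLength (a ∷ μ) z) (∸-suc k i k<i) j<))
    where
    k<i : k < i
    k<i = ℕP.≤∧≢⇒< k≤i (i≢k ∘ sym)

rowLength-decreasing : ∀ {μ} → Decreasing μ → ∀ i → rowLength μ (suc i) ≤ rowLength μ i
rowLength-decreasing []        i       = z≤n
rowLength-decreasing [-]       zero    = z≤n
rowLength-decreasing [-]       (suc i) = z≤n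
rowLength-decreasing (b≤a ∷ d) zero    = b≤a
rowLength-decreasing (b≤a ∷ d) (suc i) = rowLength-decreasing d i

ferrers-downClosed : ∀ {μ} → Decreasing μ → ∀ ax → DownClosed ax (toList (ferrers μ))
ferrers-downClosed dec X (zero  , j) c∈ p≢0 = ⊥-elim (p≢0 refl)
ferrers-downClosed {μ} dec X (suc i , j) c∈ _ =
  ∈-cellsFrom⁺ 0 μ z≤n (ℕP.<-≤-trans (proj₂ (∈-cellsFrom⁻ 0 μ c∈)) (rowLength-decreasing dec i))
ferrers-downClosed dec Y (i , zero)  c∈ q≢0 = ⊥-elim (q≢0 refl)
ferrers-downClosed {μ} dec Y (i , suc j) c∈ _ =
  ∈-cellsFrom⁺ 0 μ z≤n (ℕP.<-trans (ℕP.n<1+n j) (proj₂ (∈-cellsFrom⁻ 0 μ c∈)))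

-- ferrers/00 (suc a ∷ μ) is definitionally the list below.
ferrers/00-≢00 : ∀ a μ → All (_≢ (0 , 0)) (toList (tabulate {n = a} (λ j → 0 , toℕ (suc j)) Vec.++ cellsFrom 1 μ))
ferrers/00-≢00 a μ = All.tabulate λ {c} c∈ →
  ≢00 c (subst (c ∈_) (VecP.toList-++ (tabulate (λ j → 0 , toℕ (suc j))) (cellsFrom 1 μ)) c∈)
  where
  ≢00 : ∀ c → c ∈ toList (tabulate {n = a} (λ j → 0 , toℕ (suc j))) ++ toList (cellsFrom 1 μ) → c ≢ (0 , 0)
  ≢00 c c∈ with ∈-++⁻ (toList (tabulate {n = a} (λ j → 0 , toℕ (suc j)))) c∈
  ... | inj₁ c∈row with ∈-toList-tabulate⁻ (λ j → 0 , toℕ (suc j)) c∈row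
  ...   | j , refl = λ ()
  ≢00 c c∈ | inj₂ c∈rest with ∈-cellsFrom⁻ 1 μ c∈rest
  ... | 1≤i , _ = λ { refl → ℕP.1+n≰n 1≤i }

proposition1p1 : (n : ℕ) (μ : List ℕ) → IsPartitionOf (suc n) μ →
    ∀ {m} (B : Vec (Poly (sum μ)) m) → IsBasis (InML (ferrers μ)) B →
    IsBasis (InML (ferrers/00 μ)) (map restrict B)
proposition1p1 n []            μ⊢ B = ⊥-elim (ℕP.0≢1+n (IsPartitionOf.total μ⊢))
proposition1p1 n (zero  ∷ μ)   μ⊢ B with IsPartitionOf.positive μ⊢
... | () ∷ _
proposition1p1 n (suc a ∷ μ)   μ⊢ B =
  restrict-basis (tabulate (λ j → 0 , toℕ (suc j)) Vec.++ cellsFrom 1 μ) (ferrers/00-≢00 a μ)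
                 (ferrers-downClosed (IsPartitionOf.decreasing μ⊢)) B
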